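{- Let \[ M_1=\begin{pmatrix} -1 & 2 & 2 \\ -2 & 1 & 2 \\ -2 & 2 & 3 \end{pmatrix},\quad M_2=\begin{pmatrix} 1 & 2 & 2 \\ 2 & 1 & 2 \\ 2 & 2 & 3 \end{pmatrix},\quad M_3=\begin{pmatrix} 1 & -2 & 2 \\ 2 & -1 & 2 \\ 2 & -2 & 3 \end{pmatrix}, \] and let $M=M_{d_1}\cdots M_{d_k}$ for some $d_1,\dots,d_k\in\{1,2,3\}$, where not all $d_j$ equal $1$ and not all $d_j$ equal $3$. Then there exists a real quadratic field $K$ (with nontrivial automorphism $\sigma$ over $\mathbb{Q}$) such that: (1) one eigenvalue of $M$ is some $\lambda_1>1$ with $\lambda_1\in K$; another eigenvalue is $\lambda_2:=\lambda_1^\sigma$ with $0<\lambda_2<1$; the third eigenvalue is $\lambda_3=\det(M)\in\{1,-1\}$; (2) a nonzero eigenvector associated to $\lambda_1$ is $Q$-null (i.e.\ $x_1^2+x_2^2-x_3^2=0$) and represents a point $(\alpha,\beta)\in\mathscr{Q}$ with $\alpha,\beta\in K$; write $\mathbf{v}_1:=(\alpha,\beta,1)$; (3) $\mathbf{v}_2:=(\alpha^\sigma,\beta^\sigma,1)$ is an eigenvector associated to $\lambda_2$; (4) $\mathbf{v}_3:=\mathbf{v}_1\times_Q\mathbf{v}_2$ is an eigenvector associated to $\lambda_3$.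
   Context: $\mathscr{Q}=\{(x,y)\in\mathbb{R}^2: x\ge0,\ y\ge0,\ x^2+y^2=1\}$. A vector $(v_1,v_2,v_3)$ with $v_3\ne0$ represents the point $(v_1/v_3,v_2/v_3)\in\mathbb{R}^2$. The $Q$-cross product of $(a_1,b_1,c_1)$ and $(a_2,b_2,c_2)$ is $(b_1c_2-b_2c_1,\ a_2c_1-a_1c_2,\ a_2b_1-a_1b_2)$. -}

module Defs where

open import Data.Nat as ℕ using (ℕ)
open import Data.Integer as ℤ using (ℤ; +_; -[1+_])
open import Data.Rational as ℚ using (ℚ; 0ℚ; 1ℚ)
open import Data.Product using (_×_; _,_; proj₁; proj₂)
open import Data.Sum using (_⊎_)
open import Data.List using (List; []; _∷_; foldr)
open import Data.List.Relation.Unary.All using (All)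
open import Data.Fin using (Fin; zero; suc)
open import Relation.Binary.PropositionalEquality using (_≡_; _≢_)
open import Relation.Nullary using (¬_)

-- 3x3 integer matrices, as functions Fin 3 → Fin 3 → ℤ  (row, column)

Mat3 : Set
Mat3 = Fin 3 → Fin 3 → ℤ

i0 i1 i2 : Fin 3
i0 = zero
i1 = suc zero
i2 = suc (suc zero)

mat : ℤ → ℤ → ℤ → ℤ → ℤ → ℤ → ℤ → ℤ → ℤ → Mat3
mat a b c d e f g h i zero          zero          = a
mat a b c d e f g h i zero          (suc zero)    = b
mat a b c d e f g h i zero          (suc (suc _)) = c
mat a b c d e f g h i (suc zero)    zero          = d
mat a b c d e f g h i (suc zero)    (suc zero)    = e
mat a b c d e f g h i (suc zero)    (suc (suc _)) = f
mat a b c d e f g h i (suc (suc _)) zero          = g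
mat a b c d e f g h i (suc (suc _)) (suc zero)    = h
mat a b c d e f g h i (suc (suc _)) (suc (suc _)) = i

_⊗_ : Mat3 → Mat3 → Mat3
(A ⊗ B) r c = (A r i0 ℤ.* B i0 c ℤ.+ A r i1 ℤ.* B i1 c) ℤ.+ A r i2 ℤ.* B i2 c

I3 : Mat3
I3 = mat (+ 1) (+ 0) (+ 0) (+ 0) (+ 1) (+ 0) (+ 0) (+ 0) (+ 1)

det3 : Mat3 → ℤ
det3 A =
  (A i0 i0 ℤ.* (A i1 i1 ℤ.* A i2 i2 ℤ.- A i1 i2 ℤ.* A i2 i1)
   ℤ.- A i0 i1 ℤ.* (A i1 i0 ℤ.* A i2 i2 ℤ.- A i1 i2 ℤ.* A i2 i0))
   ℤ.+ A i0 i2 ℤ.* (A i1 i0 ℤ.* A i2 i1 ℤ.- A i1 i1 ℤ.* A i2 i0)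

data Digit : Set where
  d1 d2 d3 : Digit

-1ℤ : ℤ
-1ℤ = -[1+ 0 ]
-2ℤ : ℤ
-2ℤ = -[1+ 1 ]

Mᵈ : Digit → Mat3
Mᵈ d1 = mat -1ℤ (+ 2) (+ 2)  -2ℤ (+ 1) (+ 2)  -2ℤ (+ 2) (+ 3)
Mᵈ d2 = mat (+ 1) (+ 2) (+ 2)  (+ 2) (+ 1) (+ 2)  (+ 2) (+ 2) (+ 3)
Mᵈ d3 = mat (+ 1) -2ℤ (+ 2)  (+ 2) -1ℤ (+ 2)  (+ 2) -2ℤ (+ 3)

prodM : List Digit → Mat3
prodM = foldr (λ d A → Mᵈ d ⊗ A) I3

-- Real quadratic fields: K = ℚ(√D), D a natural number that is not a
-- perfect square; every real quadratic field is of this form.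
-- An element (a , b) stands for the real number a + b√D (√D > 0).

NonSquare : ℕ → Set
NonSquare D = ∀ n → n ℕ.* n ≢ D

module RQF (D : ℕ) where

  K : Set
  K = ℚ × ℚ

  infixl 6 _+K_ _-K_
  infixl 7 _*K_
  infix 8 -K_
  infix 4 _<K_ _≤K_
  infixr 7 _•_

  Dℚ : ℚ
  Dℚ = (+ D) ℚ./ 1

  fromℤK : ℤ → K
  fromℤK z = (z ℚ./ 1 , 0ℚ)

  0K 1K : K
  0K = (0ℚ , 0ℚ)
  1K = (1ℚ , 0ℚ)

  _+K_ : K → K → K
  (a , b) +K (c , d) = (a ℚ.+ c , b ℚ.+ d)

  -K_ : K → K
  -K (a , b) = (ℚ.- a , ℚ.- b)

  _-K_ : K → K → K
  x -K y = x +K (-K y)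

  _*K_ : K → K → K
  (a , b) *K (c , d) = (a ℚ.* c ℚ.+ Dℚ ℚ.* (b ℚ.* d) , a ℚ.* d ℚ.+ b ℚ.* c)

  σ : K → K
  σ (a , b) = (a , ℚ.- b)

  -- positivity of the real number a + b√D (with √D > 0)
  IsPos : K → Set
  IsPos (a , b) =
      (0ℚ ℚ.< a × 0ℚ ℚ.≤ b)
    ⊎ (0ℚ ℚ.≤ a × 0ℚ ℚ.< b)
    ⊎ (0ℚ ℚ.< a × b ℚ.< 0ℚ × Dℚ ℚ.* (b ℚ.* b) ℚ.< a ℚ.* a)
    ⊎ (a ℚ.< 0ℚ × 0ℚ ℚ.< b × a ℚ.* a ℚ.< Dℚ ℚ.* (b ℚ.* b))

  _<K_ : K → K → Set
  x <K y = IsPos (y -K x)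

  _≤K_ : K → K → Set
  x ≤K y = x ≡ y ⊎ x <K y

  Vec3 : Set
  Vec3 = K × K × K

  vec0 : Vec3
  vec0 = (0K , 0K , 0K)

  comp : Vec3 → Fin 3 → K
  comp (x , y , z) zero = x
  comp (x , y , z) (suc zero) = y
  comp (x , y , z) (suc (suc _)) = z

  _·_ : Mat3 → Vec3 → Vec3
  A · v = (row i0 , row i1 , row i2)
    where
    row : Fin 3 → K
    row r = (fromℤK (A r i0) *K comp v i0 +K fromℤK (A r i1) *K comp v i1)
            +K fromℤK (A r i2) *K comp v i2

  _•_ : K → Vec3 → Vec3
  c • (x , y , z) = (c *K x , c *K y , c *K z)

  IsEigenvector : Mat3 → K → Vec3 → Set
  IsEigenvector A λ' v = v ≢ vec0 × A · v ≡ λ' • v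

  QNull : Vec3 → Set
  QNull (x , y , z) = (x *K x +K y *K y) -K z *K z ≡ 0K

  -- (v₁,v₂,v₃) with v₃ ≠ 0 represents (v₁/v₃, v₂/v₃), i.e. v₁ = α v₃, v₂ = β v₃
  Represents : Vec3 → K → K → Set
  Represents (x , y , z) α β = z ≢ 0K × x ≡ α *K z × y ≡ β *K z

  In𝒬 : K → K → Set
  In𝒬 α β = 0K ≤K α × 0K ≤K β × α *K α +K β *K β ≡ 1K

  _×Q_ : Vec3 → Vec3 → Vec3
  (a₁ , b₁ , c₁) ×Q (a₂ , b₂ , c₂) =
    ( b₁ *K c₂ -K b₂ *K c₁
    , a₂ *K c₁ -K a₁ *K c₂
    , a₂ *K b₁ -K a₁ *K b₂ )

-- Write (P , K , R , S) for the 2 × 2 matrix [[P , 2K] , [R , S]].  M₁, M₂, M₃ are the images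
-- of [[1,2],[0,1]], [[1,2],[1,1]], [[1,0],[1,1]] under the homomorphism Φ determined by
-- Φ(A) null(w) = null(A w), where null(u , n) = (u² + 2un , 2un + 2n² , u² + 2un + 2n²)
-- parametrises the Q-null vectors.  So M = Φ(A) for the corresponding product A, which has
-- non-negative entries, determinant δ = ±1, and K , R > 0 unless all d_j = 1 or all d_j = 3.
-- With τ = P + S and d = τ² − 4δ, the dominant eigenvalue of A is μ/2 for μ = τ + √d, with
-- eigenvector w = (P − S + √d , 2R); hence null(w) is an eigenvector of M for λ₁ = μ²/4, its
-- conjugate belongs to λ₁^σ = 1/λ₁, and their Q-cross product to δ = det M.  Since d = τ² ∓ 4
-- lies strictly between consecutive squares, ℚ(√d) is a real quadratic field.  The identities
-- are polynomial in P, K, R, S and are checked by normalisation in ℤ[√d]; the inequalities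
-- come down to the signs of norms, which factor explicitly.
module Submission where

open import Defs
open import Data.Nat using (ℕ)
open import Data.Integer using (ℤ; +_; -[1+_])
open import Data.Product using (_×_; _,_; Σ; ∃; ∃-syntax)
open import Data.Sum using (_⊎_)
open import Data.List using (List)
open import Data.List.Relation.Unary.All using (All)
open import Relation.Binary.PropositionalEquality using (_≡_)
open import Relation.Nullary using (¬_)

import Data.Nat as ℕ
import Data.Nat.Properties as ℕ
import Data.Integer as ℤ
import Data.Integer.Properties as ℤ
open import Data.Integer.Base using (+0; +[1+_])
open import Data.Rational as ℚ using (ℚ; 0ℚ; 1ℚ; ½)
import Data.Rational.Properties as ℚ
import Data.Rational.Unnormalised as ℚᵘ
import Data.Rational.Unnormalised.Properties as ℚᵘ
open import Data.Fin using (Fin; zero; suc)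
open import Data.Fin.Patterns using (0F; 1F; 2F; 3F; 4F; 5F; 6F; 7F)
open import Data.List using ([]; _∷_; foldr)
open import Data.List.Relation.Unary.All using ([]; _∷_)
open import Data.Maybe using (Maybe; just; nothing)
open import Data.Product using (proj₁; proj₂)
open import Data.Sum using (inj₁; inj₂)
open import Data.Empty using (⊥)
open import Data.Vec using (Vec; []; _∷_)
open import Function using (id)
open import Level using (0ℓ)
open import Relation.Binary.PropositionalEquality
  using (_≢_; refl; sym; trans; cong; cong₂; subst; subst₂; isEquivalence; module ≡-Reasoning)
open import Relation.Nullary using (Dec; yes; no; contradiction)
open import Algebra.Bundles using (CommutativeRing)
open import Algebra.Consequences.Propositional using (comm∧idˡ⇒idʳ; comm∧invˡ⇒invʳ; comm∧distrʳ⇒distrˡ)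
import Algebra.Solver.Ring
import Algebra.Solver.Ring.AlmostCommutativeRing as ACR
import Data.Integer.Tactic.RingSolver as ℤ-Ring
import Data.Nat.Tactic.RingSolver as ℕ-Ring
open import Data.Rational.Solver using (module +-*-Solver)
import Tactic.RingSolver.NonReflective as NonReflective
open import Tactic.RingSolver.Core.Expression as Expr using (Expr; Κ; Ι)

-- Φ, ℤ[√d] and the Q-null vector q, as polynomials in P, K, R, S

-- Written over abstract ring operations, so that it can be read in ℤ and as solver expressions.
module Spin {A : Set} (add mul : A → A → A) (neg : A → A) (κ : ℤ → A) where

  infixl 6 _+_ _-_
  infixl 7 _*_

  _+_ _*_ _-_ : A → A → A
  _+_ = add
  _*_ = mul
  x - y = x + neg y

  Quad : Set
  Quad = A × A × A × A

  infixl 7 _∙_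
  _∙_ : Quad → Quad → Quad
  (P , K , R , S) ∙ (P′ , K′ , R′ , S′) =
    (P * P′ + κ (+ 2) * K * R′ , P * K′ + K * S′ , R * P′ + S * R′ , κ (+ 2) * R * K′ + S * S′)

  det₂ : Quad → A
  det₂ (P , K , R , S) = P * S - κ (+ 2) * K * R

  Φ : Quad → Fin 3 → Fin 3 → A
  Φ (P , K , R , S) zero zero =
    P * S + κ (+ 2) * (P * K - K * K + K * R - K * S)
  Φ (P , K , R , S) zero (suc zero) =
    P * S - P * P + κ (+ 2) * (P * K - P * R + K * R)
  Φ (P , K , R , S) zero (suc (suc _)) =
    P * P - P * S + κ (+ 2) * (P * R - P * K + K * K - K * R + K * S)
  Φ (P , K , R , S) (suc zero) zero =
    P * S - S * S + κ (+ 2) * (K * R - K * S + R * S)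
  Φ (P , K , R , S) (suc zero) (suc zero) =
    P * S + κ (+ 2) * (K * R - P * R - R * R + R * S)
  Φ (P , K , R , S) (suc zero) (suc (suc _)) =
    S * S - P * S + κ (+ 2) * (P * R - K * R + K * S + R * R - R * S)
  Φ (P , K , R , S) (suc (suc _)) zero =
    P * S - S * S + κ (+ 2) * (P * K - K * K + K * R - K * S + R * S)
  Φ (P , K , R , S) (suc (suc _)) (suc zero) =
    P * S - P * P + κ (+ 2) * (P * K - P * R + K * R - R * R + R * S)
  Φ (P , K , R , S) (suc (suc _)) (suc (suc _)) =
    P * P - P * S + S * S + κ (+ 2) * (P * R - P * K + K * K - K * R + K * S + R * R - R * S)

  -- Defs._⊗_ and Defs.det3 restated over A, so that Φ-⊗ and det-Φ can be proved by normalisation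
  _⊗ᵍ_ : (X Y : Fin 3 → Fin 3 → A) → Fin 3 → Fin 3 → A
  (X ⊗ᵍ Y) r c = (X r 0F * Y 0F c + X r 1F * Y 1F c) + X r 2F * Y 2F c

  det₃ : (Fin 3 → Fin 3 → A) → A
  det₃ X = (X 0F 0F * (X 1F 1F * X 2F 2F - X 1F 2F * X 2F 1F)
           - X 0F 1F * (X 1F 0F * X 2F 2F - X 1F 2F * X 2F 0F))
           + X 0F 2F * (X 1F 0F * X 2F 1F - X 1F 1F * X 2F 0F)

  surdA surdB : A → A → A → A
  surdA e a c = (e - a) * ((e - a) + c)
  surdB e a c = e + c

  module Eigen (P K R S : A) where

    d τ : A
    d = (P - S) * (P - S) + κ (+ 8) * K * R
    τ = P + S

    -- ℤ[√d], an element (a , b) standing for a + b√d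
    Zd : Set
    Zd = A × A

    infixl 6 _+d_ _-d_
    infixl 7 _*d_
    infixr 7 _•d_

    [_] : A → Zd
    [ a ] = (a , κ (+ 0))

    _+d_ _-d_ _*d_ : Zd → Zd → Zd
    (a , b) +d (a′ , b′) = (a + a′ , b + b′)
    (a , b) -d (a′ , b′) = (a - a′ , b - b′)
    (a , b) *d (a′ , b′) = (a * a′ + d * (b * b′) , a * b′ + b * a′)

    σd : Zd → Zd
    σd (a , b) = (a , neg b)

    Vd : Set
    Vd = Zd × Zd × Zd

    _•d_ : Zd → Vd → Vd
    c •d (x , y , z) = (c *d x , c *d y , c *d z)

    σVd : Vd → Vd
    σVd (x , y , z) = (σd x , σd y , σd z)

    Φ· : Vd → Vd
    Φ· (x , y , z) = (row 0F , row 1F , row 2F)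
      where
      row : Fin 3 → Zd
      row i = ([ Φ (P , K , R , S) i 0F ] *d x +d [ Φ (P , K , R , S) i 1F ] *d y)
              +d [ Φ (P , K , R , S) i 2F ] *d z

    _×d_ : Vd → Vd → Vd
    (a₁ , b₁ , c₁) ×d (a₂ , b₂ , c₂) =
      (b₁ *d c₂ -d b₂ *d c₁ , a₂ *d c₁ -d a₁ *d c₂ , a₂ *d b₁ -d a₁ *d b₂)

    -- μ/2 is the dominant eigenvalue of [[P , 2K] , [R , S]], with eigenvector (u , n)
    μ u n : Zd
    μ = (τ , κ (+ 1))
    u = (P - S , κ (+ 1))
    n = [ κ (+ 2) * R ]

    null : Zd → Zd → Vd
    null u n = (u *d u +d two *d u *d n , two *d u *d n +d two *d n *d n , u *d u +d two *d u *d n +d two *d n *d n)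
      where
      two : Zd
      two = [ κ (+ 2) ]

    q : Vd
    q = null u n

    q₁ q₂ q₃ : Zd
    q₁ = proj₁ q
    q₂ = proj₁ (proj₂ q)
    q₃ = proj₂ (proj₂ q)

    -- q₁ σ(q₃) = m ᾱ, q₂ σ(q₃) = m β̄ and q₃ σ(q₃) = m (B₁² + B₂²)
    e m : A
    e = P - S
    m = κ (+ 16) * R * R

    ᾱ β̄ : Zd
    ᾱ = (surdA e (κ (+ 2) * K) (κ (+ 2) * R) , surdB e (κ (+ 2) * K) (κ (+ 2) * R))
    β̄ = (surdA (neg e) (κ (+ 2) * R) (κ (+ 2) * K) , surdB (neg e) (κ (+ 2) * R) (κ (+ 2) * K))

    B₁ B₂ : A
    B₁ = proj₂ ᾱ
    B₂ = proj₂ β̄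

module ℤSpin = Spin ℤ._+_ ℤ._*_ ℤ.-_ id
open ℤSpin using (Quad; _∙_; det₂; surdA; surdB)

-- ℤSpin is the evaluation of E₄ and E₈ at their variables, so an equation between ℤSpin terms
-- follows from equal normal forms of the corresponding expressions; by-ring² and by-ring⁶ do
-- this componentwise for elements and vectors of ℤ[√d].
module ℤSolver = NonReflective ℤ-Ring.ring
open ℤSolver.Ops using (prove; ⟦_⟧; ⟦_⇓⟧)

module E₄ = Spin {Expr ℤ 4} Expr._⊕_ Expr._⊗_ Expr.⊝_ Κ
module E₈ = Spin {Expr ℤ 8} Expr._⊕_ Expr._⊗_ Expr.⊝_ Κ

⟦_⟧² : ∀ {n} → Expr ℤ n × Expr ℤ n → Vec ℤ n → ℤ × ℤ
⟦ (a , b) ⟧² ρ = (⟦ a ⟧ ρ , ⟦ b ⟧ ρ)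

by-ring² : ∀ {n} (ρ : Vec ℤ n) (x y : Expr ℤ n × Expr ℤ n) →
           ⟦ proj₁ x ⇓⟧ ρ ≡ ⟦ proj₁ y ⇓⟧ ρ → ⟦ proj₂ x ⇓⟧ ρ ≡ ⟦ proj₂ y ⇓⟧ ρ →
           ⟦ x ⟧² ρ ≡ ⟦ y ⟧² ρ
by-ring² ρ (a , b) (a′ , b′) eq eq′ = cong₂ _,_ (prove ρ a a′ eq) (prove ρ b b′ eq′)

by-ring⁶ : ∀ {n} (ρ : Vec ℤ n)
             (v w : (Expr ℤ n × Expr ℤ n) × (Expr ℤ n × Expr ℤ n) × (Expr ℤ n × Expr ℤ n)) →
           let (x , y , z) = v ; (x′ , y′ , z′) = w in
           ⟦ proj₁ x ⇓⟧ ρ ≡ ⟦ proj₁ x′ ⇓⟧ ρ → ⟦ proj₂ x ⇓⟧ ρ ≡ ⟦ proj₂ x′ ⇓⟧ ρ →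
           ⟦ proj₁ y ⇓⟧ ρ ≡ ⟦ proj₁ y′ ⇓⟧ ρ → ⟦ proj₂ y ⇓⟧ ρ ≡ ⟦ proj₂ y′ ⇓⟧ ρ →
           ⟦ proj₁ z ⇓⟧ ρ ≡ ⟦ proj₁ z′ ⇓⟧ ρ → ⟦ proj₂ z ⇓⟧ ρ ≡ ⟦ proj₂ z′ ⇓⟧ ρ →
           (⟦ x ⟧² ρ , ⟦ y ⟧² ρ , ⟦ z ⟧² ρ) ≡ (⟦ x′ ⟧² ρ , ⟦ y′ ⟧² ρ , ⟦ z′ ⟧² ρ)
by-ring⁶ ρ (x , y , z) (x′ , y′ , z′) e₁ e₂ e₃ e₄ e₅ e₆ =
  cong₂ _,_ (by-ring² ρ x x′ e₁ e₂) (cong₂ _,_ (by-ring² ρ y y′ e₃ e₄) (by-ring² ρ z z′ e₅ e₆))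

ΦM : Quad → Mat3
ΦM X = mat (Φ X 0F 0F) (Φ X 0F 1F) (Φ X 0F 2F)
           (Φ X 1F 0F) (Φ X 1F 1F) (Φ X 1F 2F)
           (Φ X 2F 0F) (Φ X 2F 1F) (Φ X 2F 2F)
  where open ℤSpin using (Φ)

Φ-⊗ : ∀ X Y i j → (ΦM X ⊗ ΦM Y) i j ≡ ΦM (X ∙ Y) i j
Φ-⊗ (P , K , R , S) (P′ , K′ , R′ , S′) = entrywise
  where
  ρ : Vec ℤ 8
  ρ = P ∷ K ∷ R ∷ S ∷ P′ ∷ K′ ∷ R′ ∷ S′ ∷ []
  X Y : E₈.Quad
  X = (Ι 0F , Ι 1F , Ι 2F , Ι 3F)
  Y = (Ι 4F , Ι 5F , Ι 6F , Ι 7F)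
  lhs rhs : Fin 3 → Fin 3 → Expr ℤ 8
  lhs = E₈.Φ X E₈.⊗ᵍ E₈.Φ Y
  rhs = E₈.Φ (X E₈.∙ Y)
  entrywise : ∀ i j → (ΦM (P , K , R , S) ⊗ ΦM (P′ , K′ , R′ , S′)) i j
                     ≡ ΦM ((P , K , R , S) ∙ (P′ , K′ , R′ , S′)) i j
  entrywise zero          zero          = prove ρ (lhs 0F 0F) (rhs 0F 0F) refl
  entrywise zero          (suc zero)    = prove ρ (lhs 0F 1F) (rhs 0F 1F) refl
  entrywise zero          (suc (suc j)) = prove ρ (lhs 0F (suc (suc j))) (rhs 0F (suc (suc j))) refl
  entrywise (suc zero)    zero          = prove ρ (lhs 1F 0F) (rhs 1F 0F) refl
  entrywise (suc zero)    (suc zero)    = prove ρ (lhs 1F 1F) (rhs 1F 1F) refl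
  entrywise (suc zero)    (suc (suc j)) = prove ρ (lhs 1F (suc (suc j))) (rhs 1F (suc (suc j))) refl
  entrywise (suc (suc i)) zero          = prove ρ (lhs (suc (suc i)) 0F) (rhs (suc (suc i)) 0F) refl
  entrywise (suc (suc i)) (suc zero)    = prove ρ (lhs (suc (suc i)) 1F) (rhs (suc (suc i)) 1F) refl
  entrywise (suc (suc i)) (suc (suc j)) = prove ρ (lhs (suc (suc i)) (suc (suc j))) (rhs (suc (suc i)) (suc (suc j))) refl

det₂-∙ : ∀ X Y → det₂ (X ∙ Y) ≡ det₂ X ℤ.* det₂ Y
det₂-∙ (P , K , R , S) (P′ , K′ , R′ , S′) =
  prove (P ∷ K ∷ R ∷ S ∷ P′ ∷ K′ ∷ R′ ∷ S′ ∷ [])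
        (E₈.det₂ (X E₈.∙ Y)) (E₈.det₂ X Expr.⊗ E₈.det₂ Y) refl
  where
  X Y : E₈.Quad
  X = (Ι 0F , Ι 1F , Ι 2F , Ι 3F)
  Y = (Ι 4F , Ι 5F , Ι 6F , Ι 7F)

det-Φ : ∀ X → det3 (ΦM X) ≡ det₂ X ℤ.* det₂ X ℤ.* det₂ X
det-Φ (P , K , R , S) =
  prove (P ∷ K ∷ R ∷ S ∷ []) (E₄.det₃ (E₄.Φ X)) (E₄.det₂ X E₄.* E₄.det₂ X E₄.* E₄.det₂ X) refl
  where
  X : E₄.Quad
  X = (Ι 0F , Ι 1F , Ι 2F , Ι 3F)

⊗-congʳ : ∀ A B C {i j} → (∀ l → B l j ≡ C l j) → (A ⊗ B) i j ≡ (A ⊗ C) i j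
⊗-congʳ A B C {i} B≈C = cong₂ ℤ._+_ (cong₂ ℤ._+_ (cong (A i 0F ℤ.*_) (B≈C 0F)) (cong (A i 1F ℤ.*_) (B≈C 1F)))
                                    (cong (A i 2F ℤ.*_) (B≈C 2F))

det3-cong : ∀ {A B} → (∀ i j → A i j ≡ B i j) → det3 A ≡ det3 B
det3-cong {A} {B} A≈B =
  cong₂ ℤ._+_ (cong₂ ℤ._-_ (cong₂ ℤ._*_ (A≈B 0F 0F) (minor 1F 1F 2F 2F 1F 2F 2F 1F))
                           (cong₂ ℤ._*_ (A≈B 0F 1F) (minor 1F 0F 2F 2F 1F 2F 2F 0F)))
              (cong₂ ℤ._*_ (A≈B 0F 2F) (minor 1F 0F 2F 1F 1F 1F 2F 0F))
  where
  minor : ∀ a b c d e f g h → A a b ℤ.* A c d ℤ.- A e f ℤ.* A g h ≡ B a b ℤ.* B c d ℤ.- B e f ℤ.* B g h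
  minor a b c d e f g h = cong₂ ℤ._-_ (cong₂ ℤ._*_ (A≈B a b) (A≈B c d)) (cong₂ ℤ._*_ (A≈B e f) (A≈B g h))

-- The field ℚ(√D)

ι : ℤ → ℚ
ι z = z ℚ./ 1

private
  toℚᵘ-ι : ∀ z → ℚ.toℚᵘ (ι z) ℚᵘ.≃ ℚᵘ.mkℚᵘ z 0
  toℚᵘ-ι z = ℚ.toℚᵘ-fromℚᵘ (ℚᵘ.mkℚᵘ z 0)

ι-+ : ∀ a b → ι (a ℤ.+ b) ≡ ι a ℚ.+ ι b
ι-+ a b = ℚ.toℚᵘ-injective (begin
  ℚ.toℚᵘ (ι (a ℤ.+ b))                 ≈⟨ toℚᵘ-ι (a ℤ.+ b) ⟩
  ℚᵘ.mkℚᵘ (a ℤ.+ b) 0                  ≈⟨ ℚᵘ.*≡* (cross-multiplied a b) ⟩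
  ℚᵘ.mkℚᵘ a 0 ℚᵘ.+ ℚᵘ.mkℚᵘ b 0          ≈⟨ ℚᵘ.+-cong (toℚᵘ-ι a) (toℚᵘ-ι b) ⟨
  ℚ.toℚᵘ (ι a) ℚᵘ.+ ℚ.toℚᵘ (ι b)        ≈⟨ ℚ.toℚᵘ-homo-+ (ι a) (ι b) ⟨
  ℚ.toℚᵘ (ι a ℚ.+ ι b)                 ∎)
  where
  open ℚᵘ.≃-Reasoning
  cross-multiplied : ∀ a b → (a ℤ.+ b) ℤ.* + 1 ≡ (a ℤ.* + 1 ℤ.+ b ℤ.* + 1) ℤ.* + 1
  cross-multiplied = ℤ-Ring.solve-∀

ι-* : ∀ a b → ι (a ℤ.* b) ≡ ι a ℚ.* ι b
ι-* a b = ℚ.toℚᵘ-injective (begin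
  ℚ.toℚᵘ (ι (a ℤ.* b))                 ≈⟨ toℚᵘ-ι (a ℤ.* b) ⟩
  ℚᵘ.mkℚᵘ a 0 ℚᵘ.* ℚᵘ.mkℚᵘ b 0          ≈⟨ ℚᵘ.*-cong (toℚᵘ-ι a) (toℚᵘ-ι b) ⟨
  ℚ.toℚᵘ (ι a) ℚᵘ.* ℚ.toℚᵘ (ι b)        ≈⟨ ℚ.toℚᵘ-homo-* (ι a) (ι b) ⟨
  ℚ.toℚᵘ (ι a ℚ.* ι b)                 ∎)
  where open ℚᵘ.≃-Reasoning

ι-neg : ∀ a → ι (ℤ.- a) ≡ ℚ.- ι a
ι-neg a = ℚ.toℚᵘ-injective (begin
  ℚ.toℚᵘ (ι (ℤ.- a))   ≈⟨ toℚᵘ-ι (ℤ.- a) ⟩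
  ℚᵘ.- ℚᵘ.mkℚᵘ a 0     ≈⟨ ℚᵘ.-‿cong (toℚᵘ-ι a) ⟨
  ℚᵘ.- ℚ.toℚᵘ (ι a)    ≈⟨ ℚ.toℚᵘ-homo‿- (ι a) ⟨
  ℚ.toℚᵘ (ℚ.- ι a)     ∎)
  where open ℚᵘ.≃-Reasoning

ι-< : ∀ {a b} → a ℤ.< b → ι a ℚ.< ι b
ι-< {a} {b} a<b = ℚ.toℚᵘ-cancel-<
  (ℚᵘ.<-respˡ-≃ (ℚᵘ.≃-sym (toℚᵘ-ι a)) (ℚᵘ.<-respʳ-≃ (ℚᵘ.≃-sym (toℚᵘ-ι b))
    (ℚᵘ.*<* (subst₂ ℤ._<_ (sym (ℤ.*-identityʳ a)) (sym (ℤ.*-identityʳ b)) a<b))))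

ι-≤ : ∀ {a b} → a ℤ.≤ b → ι a ℚ.≤ ι b
ι-≤ {a} {b} a≤b = ℚ.toℚᵘ-cancel-≤
  (ℚᵘ.≤-respˡ-≃ (ℚᵘ.≃-sym (toℚᵘ-ι a)) (ℚᵘ.≤-respʳ-≃ (ℚᵘ.≃-sym (toℚᵘ-ι b))
    (ℚᵘ.*≤* (subst₂ ℤ._≤_ (sym (ℤ.*-identityʳ a)) (sym (ℤ.*-identityʳ b)) a≤b))))

-- A + B√d > 0, witnessed by the signs of A, B and of the norm A² − d B²
PositiveSurd : ℤ → ℤ → ℤ → Set
PositiveSurd d A B = (+ 0 ℤ.< B × (A ℤ.< + 0 → A ℤ.* A ℤ.< d ℤ.* (B ℤ.* B)))
                   ⊎ (+ 0 ℤ.< A × (B ℤ.< + 0 → d ℤ.* (B ℤ.* B) ℤ.< A ℤ.* A))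

module QuadraticField (D : ℕ) where

  open RQF D

  +K-assoc : ∀ x y z → (x +K y) +K z ≡ x +K (y +K z)
  +K-assoc (a , b) (c , d) (e , f) = cong₂ _,_ (ℚ.+-assoc a c e) (ℚ.+-assoc b d f)

  +K-comm : ∀ x y → x +K y ≡ y +K x
  +K-comm (a , b) (c , d) = cong₂ _,_ (ℚ.+-comm a c) (ℚ.+-comm b d)

  +K-identityˡ : ∀ x → 0K +K x ≡ x
  +K-identityˡ (a , b) = cong₂ _,_ (ℚ.+-identityˡ a) (ℚ.+-identityˡ b)

  -K-inverseˡ : ∀ x → (-K x) +K x ≡ 0K
  -K-inverseˡ (a , b) = cong₂ _,_ (ℚ.+-inverseˡ a) (ℚ.+-inverseˡ b)

  *K-comm : ∀ x y → x *K y ≡ y *K x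
  *K-comm (a , b) (c , d) = cong₂ _,_
    (solve 5 (λ a b c d D → a :* c :+ D :* (b :* d) := c :* a :+ D :* (d :* b)) refl a b c d Dℚ)
    (solve 4 (λ a b c d → a :* d :+ b :* c := c :* b :+ d :* a) refl a b c d)
    where open +-*-Solver

  *K-assoc : ∀ x y z → (x *K y) *K z ≡ x *K (y *K z)
  *K-assoc (a , b) (c , d) (e , f) = cong₂ _,_
    (solve 7 (λ a b c d e f D → (a :* c :+ D :* (b :* d)) :* e :+ D :* ((a :* d :+ b :* c) :* f)
                              := a :* (c :* e :+ D :* (d :* f)) :+ D :* (b :* (c :* f :+ d :* e))) refl a b c d e f Dℚ)
    (solve 7 (λ a b c d e f D → (a :* c :+ D :* (b :* d)) :* f :+ (a :* d :+ b :* c) :* e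
                              := a :* (c :* f :+ d :* e) :+ b :* (c :* e :+ D :* (d :* f))) refl a b c d e f Dℚ)
    where open +-*-Solver

  *K-identityˡ : ∀ x → 1K *K x ≡ x
  *K-identityˡ (a , b) = cong₂ _,_
    (solve 3 (λ a b D → con 1ℚ :* a :+ D :* (con 0ℚ :* b) := a) refl a b Dℚ)
    (solve 2 (λ a b → con 1ℚ :* b :+ con 0ℚ :* a := b) refl a b)
    where open +-*-Solver

  *K-distribʳ : ∀ x y z → (y +K z) *K x ≡ y *K x +K z *K x
  *K-distribʳ (a , b) (c , d) (e , f) = cong₂ _,_
    (solve 7 (λ a b c d e f D → (c :+ e) :* a :+ D :* ((d :+ f) :* b)
                              := (c :* a :+ D :* (d :* b)) :+ (e :* a :+ D :* (f :* b))) refl a b c d e f Dℚ)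
    (solve 6 (λ a b c d e f → (c :+ e) :* b :+ (d :+ f) :* a := (c :* b :+ d :* a) :+ (e :* b :+ f :* a)) refl a b c d e f)
    where open +-*-Solver

  ring : CommutativeRing 0ℓ 0ℓ
  ring = record
    { Carrier = K ; _≈_ = _≡_ ; _+_ = _+K_ ; _*_ = _*K_ ; -_ = λ x → -K x ; 0# = 0K ; 1# = 1K
    ; isCommutativeRing = record
      { isRing = record
        { +-isAbelianGroup = record
          { isGroup = record
            { isMonoid = record
              { isSemigroup = record
                { isMagma = record { isEquivalence = isEquivalence ; ∙-cong = cong₂ _+K_ }
                ; assoc = +K-assoc }
              ; identity = +K-identityˡ , comm∧idˡ⇒idʳ +K-comm +K-identityˡ }
            ; inverse = -K-inverseˡ , comm∧invˡ⇒invʳ +K-comm -K-inverseˡ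
            ; ⁻¹-cong = cong (λ x → -K x) }
          ; comm = +K-comm }
        ; *-cong = cong₂ _*K_
        ; *-assoc = *K-assoc
        ; *-identity = *K-identityˡ , comm∧idˡ⇒idʳ *K-comm *K-identityˡ
        ; distrib = comm∧distrʳ⇒distrˡ *K-comm *K-distribʳ , *K-distribʳ }
      ; *-comm = *K-comm } }

  fromℚ : ℚ → K
  fromℚ a = (a , 0ℚ)

  fromℚ-*ˡ : ∀ t a b → fromℚ t *K (a , b) ≡ (t ℚ.* a , t ℚ.* b)
  fromℚ-*ˡ t a b = cong₂ _,_
    (solve 4 (λ t a b D → t :* a :+ D :* (con 0ℚ :* b) := t :* a) refl t a b Dℚ)
    (solve 3 (λ t a b → t :* b :+ con 0ℚ :* a := t :* b) refl t a b)
    where open +-*-Solver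

  fromℚ-* : ∀ a b → fromℚ a *K fromℚ b ≡ fromℚ (a ℚ.* b)
  fromℚ-* a b = trans (fromℚ-*ˡ a b 0ℚ) (cong (a ℚ.* b ,_) (ℚ.*-zeroʳ a))

  private
    fromℚ-≟ : ∀ a b → Maybe (fromℚ a ≡ fromℚ b)
    fromℚ-≟ a b with a ℚ.≟ b
    ... | yes a≡b = just (cong fromℚ a≡b)
    ... | no _    = nothing

    fromℚ-morphism : ℚ.+-*-rawRing ACR.-Raw-AlmostCommutative⟶ ACR.fromCommutativeRing ring
    fromℚ-morphism = record
      { ⟦_⟧ = fromℚ ; +-homo = λ _ _ → refl ; *-homo = λ a b → sym (fromℚ-* a b)
      ; -‿homo = λ _ → refl ; 0-homo = refl ; 1-homo = refl }

  -- coefficients in ℚ, so that closed constants compute while Dℚ stays symbolic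
  module K-Solver = Algebra.Solver.Ring ℚ.+-*-rawRing (ACR.fromCommutativeRing ring) fromℚ-morphism fromℚ-≟

  σ-+ : ∀ x y → σ (x +K y) ≡ σ x +K σ y
  σ-+ (a , b) (c , d) = cong (a ℚ.+ c ,_) (ℚ.neg-distrib-+ b d)

  σ-* : ∀ x y → σ (x *K y) ≡ σ x *K σ y
  σ-* (a , b) (c , d) = cong₂ _,_
    (solve 5 (λ a b c d D → a :* c :+ D :* (b :* d) := a :* c :+ D :* (:- b :* :- d)) refl a b c d Dℚ)
    (solve 4 (λ a b c d → :- (a :* d :+ b :* c) := a :* :- d :+ :- b :* c) refl a b c d)
    where open +-*-Solver

  σ-fixed⇒rational : ∀ {x} → σ x ≡ x → proj₂ x ≡ 0ℚ
  σ-fixed⇒rational {a , b} σx≡x = begin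
    b                  ≡⟨ solve 1 (λ b → b := con ½ :* (b :- :- b)) refl b ⟩
    ½ ℚ.* (b ℚ.- ℚ.- b) ≡⟨ cong (λ c → ½ ℚ.* (b ℚ.- c)) (cong proj₂ σx≡x) ⟩
    ½ ℚ.* (b ℚ.- b)     ≡⟨ solve 1 (λ b → con ½ :* (b :- b) := con 0ℚ) refl b ⟩
    0ℚ                 ∎
    where
    open +-*-Solver
    open ≡-Reasoning

  σV : Vec3 → Vec3
  σV (x , y , z) = (σ x , σ y , σ z)

  ·-cong : ∀ {A B} → (∀ i j → A i j ≡ B i j) → ∀ v → A · v ≡ B · v
  ·-cong {A} {B} A≈B (x , y , z) = cong₂ _,_ (row i0) (cong₂ _,_ (row i1) (row i2))
    where
    entry : ∀ i j w → fromℤK (A i j) *K w ≡ fromℤK (B i j) *K w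
    entry i j w = cong (λ a → fromℤK a *K w) (A≈B i j)
    row : ∀ i → (fromℤK (A i i0) *K x +K fromℤK (A i i1) *K y) +K fromℤK (A i i2) *K z
              ≡ (fromℤK (B i i0) *K x +K fromℤK (B i i1) *K y) +K fromℤK (B i i2) *K z
    row i = cong₂ _+K_ (cong₂ _+K_ (entry i i0 x) (entry i i1 y)) (entry i i2 z)

  ·-• : ∀ A c v → A · (c • v) ≡ c • (A · v)
  ·-• A c (x , y , z) = cong₂ _,_ (row i0) (cong₂ _,_ (row i1) (row i2))
    where
    open K-Solver
    row : ∀ i → let a = fromℤK (A i i0) ; b = fromℤK (A i i1) ; e = fromℤK (A i i2) in
          (a *K (c *K x) +K b *K (c *K y)) +K e *K (c *K z) ≡ c *K ((a *K x +K b *K y) +K e *K z)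
    row i = solve 7 (λ a b e c x y z → (a :* (c :* x) :+ b :* (c :* y)) :+ e :* (c :* z)
                                     := c :* ((a :* x :+ b :* y) :+ e :* z)) refl
              (fromℤK (A i i0)) (fromℤK (A i i1)) (fromℤK (A i i2)) c x y z

  •-comm : ∀ c l v → c • (l • v) ≡ l • (c • v)
  •-comm c l (x , y , z) = cong₂ _,_ (swap x) (cong₂ _,_ (swap y) (swap z))
    where
    open K-Solver
    swap : ∀ x → c *K (l *K x) ≡ l *K (c *K x)
    swap = solve 3 (λ c l x → c :* (l :* x) := l :* (c :* x)) refl c l

  •-assoc : ∀ a b v → a • (b • v) ≡ (a *K b) • v
  •-assoc a b (x , y , z) =
    cong₂ _,_ (sym (*K-assoc a b x)) (cong₂ _,_ (sym (*K-assoc a b y)) (sym (*K-assoc a b z)))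

  •-identity : ∀ v → 1K • v ≡ v
  •-identity (x , y , z) = cong₂ _,_ (*K-identityˡ x) (cong₂ _,_ (*K-identityˡ y) (*K-identityˡ z))

  eigen-scale : ∀ A l c v → A · v ≡ l • v → A · (c • v) ≡ l • (c • v)
  eigen-scale A l c v Av≡lv = trans (·-• A c v) (trans (cong (c •_) Av≡lv) (•-comm c l v))

  conjugate-cross≡0 : ∀ α β → (α , β , 1K) ×Q (σ α , σ β , 1K) ≡ vec0 → σ α ≡ α × σ β ≡ β
  conjugate-cross≡0 α β cross≡0 =
    difference≡0 (σ α) α (cong (λ v → proj₁ (proj₂ v)) cross≡0) ,
    sym (difference≡0 β (σ β) (cong proj₁ cross≡0))
    where
    open K-Solver
    difference≡0 : ∀ x y → x *K 1K -K y *K 1K ≡ 0K → x ≡ y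
    difference≡0 x y x-y≡0 = begin
      x                              ≡⟨ solve 2 (λ x y → x := (x :* con 1ℚ :- y :* con 1ℚ) :+ y) refl x y ⟩
      (x *K 1K -K y *K 1K) +K y      ≡⟨ cong (_+K y) x-y≡0 ⟩
      0K +K y                        ≡⟨ +K-identityˡ y ⟩
      y                              ∎
      where open ≡-Reasoning

  σ-· : ∀ A v → σV (A · v) ≡ A · σV v
  σ-· A (x , y , z) = cong₂ _,_ (row i0) (cong₂ _,_ (row i1) (row i2))
    where
    row : ∀ i → σ ((fromℤK (A i i0) *K x +K fromℤK (A i i1) *K y) +K fromℤK (A i i2) *K z)
              ≡ (fromℤK (A i i0) *K σ x +K fromℤK (A i i1) *K σ y) +K fromℤK (A i i2) *K σ z
    row i = trans (σ-+ (a *K x +K b *K y) (e *K z))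
                  (cong₂ _+K_ (trans (σ-+ (a *K x) (b *K y)) (cong₂ _+K_ (σ-* a x) (σ-* b y))) (σ-* e z))
      where
      a b e : K
      a = fromℤK (A i i0)
      b = fromℤK (A i i1)
      e = fromℤK (A i i2)

  σ-• : ∀ c v → σV (c • v) ≡ σ c • σV v
  σ-• c (x , y , z) = cong₂ _,_ (σ-* c x) (cong₂ _,_ (σ-* c y) (σ-* c z))

  ×Q-• : ∀ a b v w → (a • v) ×Q (b • w) ≡ (a *K b) • (v ×Q w)
  ×Q-• a b (a₁ , b₁ , c₁) (a₂ , b₂ , c₂) =
    cong₂ _,_ (first b₁ c₂ b₂ c₁) (cong₂ _,_ (other a₂ c₁ a₁ c₂) (other a₂ b₁ a₁ b₂))
    where
    open K-Solver
    first : ∀ x y z w → (a *K x) *K (b *K y) -K (b *K z) *K (a *K w) ≡ (a *K b) *K (x *K y -K z *K w)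
    first = solve 6 (λ a b x y z w → (a :* x) :* (b :* y) :- (b :* z) :* (a :* w)
                                   := (a :* b) :* (x :* y :- z :* w)) refl a b
    other : ∀ x y z w → (b *K x) *K (a *K y) -K (a *K z) *K (b *K w) ≡ (a *K b) *K (x *K y -K z *K w)
    other = solve 6 (λ a b x y z w → (b :* x) :* (a :* y) :- (a :* z) :* (b :* w)
                                   := (a :* b) :* (x :* y :- z :* w)) refl a b

  IsPos-scale : ∀ {t} x → 0ℚ ℚ.< t → IsPos x → IsPos (fromℚ t *K x)
  IsPos-scale {t} (a , b) t>0 a+b√D>0 = subst IsPos (sym (fromℚ-*ˡ t a b)) (scaled a+b√D>0)
    where
    instance
      t-pos : ℚ.Positive t
      t-pos = ℚ.positive t>0
      t-nonneg : ℚ.NonNegative t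
      t-nonneg = ℚ.nonNegative (ℚ.<⇒≤ t>0)
      tt-pos : ℚ.Positive (t ℚ.* t)
      tt-pos = ℚ.positive (subst (ℚ._< t ℚ.* t) (ℚ.*-zeroʳ t) (ℚ.*-monoʳ-<-pos t t>0))
    pos : ∀ {x} → 0ℚ ℚ.< x → 0ℚ ℚ.< t ℚ.* x
    pos {x} x>0 = subst (ℚ._< t ℚ.* x) (ℚ.*-zeroʳ t) (ℚ.*-monoʳ-<-pos t x>0)
    neg : ∀ {x} → x ℚ.< 0ℚ → t ℚ.* x ℚ.< 0ℚ
    neg {x} x<0 = subst (t ℚ.* x ℚ.<_) (ℚ.*-zeroʳ t) (ℚ.*-monoʳ-<-pos t x<0)
    nonneg : ∀ {x} → 0ℚ ℚ.≤ x → 0ℚ ℚ.≤ t ℚ.* x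
    nonneg {x} x≥0 = subst (ℚ._≤ t ℚ.* x) (ℚ.*-zeroʳ t) (ℚ.*-monoˡ-≤-nonNeg t x≥0)
    squares : ∀ x y → (t ℚ.* x) ℚ.* (t ℚ.* x) ≡ (t ℚ.* t) ℚ.* (x ℚ.* x)
                    × Dℚ ℚ.* ((t ℚ.* y) ℚ.* (t ℚ.* y)) ≡ (t ℚ.* t) ℚ.* (Dℚ ℚ.* (y ℚ.* y))
    squares x y = solve 3 (λ t x D → (t :* x) :* (t :* x) := (t :* t) :* (x :* x)) refl t x Dℚ
                , solve 3 (λ t y D → D :* ((t :* y) :* (t :* y)) := (t :* t) :* (D :* (y :* y))) refl t y Dℚ
      where open +-*-Solver
    sq< : ∀ {u v} → u ℚ.< v → (t ℚ.* t) ℚ.* u ℚ.< (t ℚ.* t) ℚ.* v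
    sq< = ℚ.*-monoʳ-<-pos (t ℚ.* t)
    scaled : IsPos (a , b) → IsPos (t ℚ.* a , t ℚ.* b)
    scaled (inj₁ (a>0 , b≥0)) = inj₁ (pos a>0 , nonneg b≥0)
    scaled (inj₂ (inj₁ (a≥0 , b>0))) = inj₂ (inj₁ (nonneg a≥0 , pos b>0))
    scaled (inj₂ (inj₂ (inj₁ (a>0 , b<0 , Db²<a²)))) = inj₂ (inj₂ (inj₁ (pos a>0 , neg b<0 ,
      subst₂ ℚ._<_ (sym (proj₂ (squares a b))) (sym (proj₁ (squares a b))) (sq< Db²<a²))))
    scaled (inj₂ (inj₂ (inj₂ (a<0 , b>0 , a²<Db²)))) = inj₂ (inj₂ (inj₂ (neg a<0 , pos b>0 ,
      subst₂ ℚ._<_ (sym (proj₁ (squares a b))) (sym (proj₂ (squares a b))) (sq< a²<Db²))))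

  private
    ι-d*B² : ∀ {d B} → + D ≡ d → ι (d ℤ.* (B ℤ.* B)) ≡ Dℚ ℚ.* (ι B ℚ.* ι B)
    ι-d*B² {d} {B} refl = trans (ι-* (+ D) (B ℤ.* B)) (cong (Dℚ ℚ.*_) (ι-* B B))

  IsPos-ι : ∀ {d A B} → + D ≡ d → PositiveSurd d A B → IsPos (ι A , ι B)
  IsPos-ι {d} {A} {B} D≡d (inj₁ (B>0 , A<0⇒A²<dB²)) with A ℤ.<? + 0
  ... | yes A<0 = inj₂ (inj₂ (inj₂ (ι-< A<0 , ι-< B>0 ,
                    subst₂ ℚ._<_ (ι-* A A) (ι-d*B² {B = B} D≡d) (ι-< (A<0⇒A²<dB² A<0)))))
  ... | no A≮0  = inj₂ (inj₁ (ι-≤ (ℤ.≮⇒≥ A≮0) , ι-< B>0))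
  IsPos-ι {d} {A} {B} D≡d (inj₂ (A>0 , B<0⇒dB²<A²)) with B ℤ.<? + 0
  ... | yes B<0 = inj₂ (inj₂ (inj₁ (ι-< A>0 , ι-< B<0 ,
                    subst₂ ℚ._<_ (ι-d*B² {B = B} D≡d) (ι-* A A) (ι-< (B<0⇒dB²<A² B<0)))))
  ... | no B≮0  = inj₁ (ι-< A>0 , ι-≤ (ℤ.≮⇒≥ B≮0))

<-+pos : ∀ {x y z} → + 0 ℤ.< z → x ℤ.+ z ≡ y → x ℤ.< y
<-+pos {x} {_} {z} z>0 refl = subst (ℤ._< x ℤ.+ z) (ℤ.+-identityʳ x) (ℤ.+-monoʳ-< x z>0)

*-pos-pos : ∀ {x y} → + 0 ℤ.< x → + 0 ℤ.< y → + 0 ℤ.< x ℤ.* y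
*-pos-pos {+[1+ _ ]} {+[1+ _ ]} _ _ = ℤ.+<+ (ℕ.s≤s ℕ.z≤n)
*-pos-pos {+0} (ℤ.+<+ ()) _
*-pos-pos {+[1+ _ ]} {+0} _ (ℤ.+<+ ())

*-neg-neg : ∀ {x y} → x ℤ.< + 0 → y ℤ.< + 0 → + 0 ℤ.< x ℤ.* y
*-neg-neg { -[1+ _ ]} { -[1+ _ ]} _ _ = ℤ.+<+ (ℕ.s≤s ℕ.z≤n)
*-neg-neg {+ _} (ℤ.+<+ ())
*-neg-neg { -[1+ _ ]} {+ _} _ (ℤ.+<+ ())

square-nonneg : ∀ x → + 0 ℤ.≤ x ℤ.* x
square-nonneg +0        = ℤ.+≤+ ℕ.z≤n
square-nonneg +[1+ _ ]  = ℤ.+≤+ ℕ.z≤n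
square-nonneg -[1+ _ ]  = ℤ.+≤+ ℕ.z≤n

square-pos : ∀ {x} → x ≢ + 0 → + 0 ℤ.< x ℤ.* x
square-pos {+0}       x≢0 = contradiction refl x≢0
square-pos {+[1+ _ ]} _   = ℤ.+<+ (ℕ.s≤s ℕ.z≤n)
square-pos { -[1+ _ ]} _  = ℤ.+<+ (ℕ.s≤s ℕ.z≤n)

sum-of-squares-pos : ∀ x {y} → y ≢ + 0 → + 0 ℤ.< x ℤ.* x ℤ.+ y ℤ.* y
sum-of-squares-pos x y≢0 = ℤ.+-mono-≤-< (square-nonneg x) (square-pos y≢0)

positive-summand : ∀ {x y} → + 0 ℤ.< x ℤ.+ y → x ℤ.≤ + 0 → + 0 ℤ.< y
positive-summand {x} {y} x+y>0 x≤0 = subst (+ 0 ℤ.<_) (ℤ.+-identityˡ y) (ℤ.<-≤-trans x+y>0 (ℤ.+-monoˡ-≤ y x≤0))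

-- The norm (e² + 2ac) B² − A² of A + B√(e² + 2ac) is a s (E² + B²), where
-- E = e − a and s = (E + c) + B, so its sign is the sign of s.
surd-positive : ∀ e {a c} → + 0 ℤ.< a → + 0 ℤ.< c →
                PositiveSurd (e ℤ.* e ℤ.+ + 2 ℤ.* a ℤ.* c) (surdA e a c) (surdB e a c)
surd-positive e {a} {c} a>0 c>0 = by-sign-of-B (+ 0 ℤ.<? B)
  where
  E B s : ℤ
  E = e ℤ.- a
  B = surdB e a c
  s = (E ℤ.+ c) ℤ.+ B

  norm : ∀ e a c → let E = e ℤ.- a ; B = e ℤ.+ c ; s = (E ℤ.+ c) ℤ.+ B in
         (e ℤ.* e ℤ.+ + 2 ℤ.* a ℤ.* c) ℤ.* (B ℤ.* B)
         ≡ (E ℤ.* (E ℤ.+ c)) ℤ.* (E ℤ.* (E ℤ.+ c)) ℤ.+ a ℤ.* s ℤ.* (E ℤ.* E ℤ.+ B ℤ.* B)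
  norm = ℤ-Ring.solve-∀

  norm′ : ∀ e a c → let E = e ℤ.- a ; B = e ℤ.+ c ; s = (E ℤ.+ c) ℤ.+ B in
          (E ℤ.* (E ℤ.+ c)) ℤ.* (E ℤ.* (E ℤ.+ c))
          ≡ (e ℤ.* e ℤ.+ + 2 ℤ.* a ℤ.* c) ℤ.* (B ℤ.* B) ℤ.+ a ℤ.* ℤ.- s ℤ.* (E ℤ.* E ℤ.+ B ℤ.* B)
  norm′ = ℤ-Ring.solve-∀

  E<E+c : E ℤ.< E ℤ.+ c
  E<E+c = <-+pos c>0 refl

  E+c<B : E ℤ.+ c ℤ.< B
  E+c<B = <-+pos a>0 (identity e a c)
    where
    identity : ∀ e a c → (e ℤ.- a ℤ.+ c) ℤ.+ a ≡ e ℤ.+ c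
    identity = ℤ-Ring.solve-∀

  by-sign-of-B : Dec (+ 0 ℤ.< B) → PositiveSurd (e ℤ.* e ℤ.+ + 2 ℤ.* a ℤ.* c) (surdA e a c) B
  by-sign-of-B (yes B>0) = inj₁ (B>0 , λ A<0 → <-+pos (norm>0 A<0) (sym (norm e a c)))
    where
    E+c≥0 : surdA e a c ℤ.< + 0 → + 0 ℤ.≤ E ℤ.+ c
    E+c≥0 A<0 with E ℤ.+ c ℤ.<? + 0
    ... | yes E+c<0 = contradiction (*-neg-neg (ℤ.<-trans E<E+c E+c<0) E+c<0) (ℤ.<-asym A<0)
    ... | no E+c≮0  = ℤ.≮⇒≥ E+c≮0
    norm>0 : surdA e a c ℤ.< + 0 → + 0 ℤ.< a ℤ.* s ℤ.* (E ℤ.* E ℤ.+ B ℤ.* B)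
    norm>0 A<0 = *-pos-pos (*-pos-pos a>0 (ℤ.+-mono-≤-< (E+c≥0 A<0) B>0))
                           (sum-of-squares-pos E (λ B≡0 → ℤ.<⇒≢ B>0 (sym B≡0)))
  by-sign-of-B (no B≯0) = inj₂ (A>0 , λ B<0 → <-+pos (norm>0 B<0) (sym (norm′ e a c)))
    where
    E+c<0 : E ℤ.+ c ℤ.< + 0
    E+c<0 = ℤ.<-≤-trans E+c<B (ℤ.≮⇒≥ B≯0)
    A>0 : + 0 ℤ.< surdA e a c
    A>0 = *-neg-neg (ℤ.<-trans E<E+c E+c<0) E+c<0
    norm>0 : B ℤ.< + 0 → + 0 ℤ.< a ℤ.* ℤ.- s ℤ.* (E ℤ.* E ℤ.+ B ℤ.* B)
    norm>0 B<0 = *-pos-pos (*-pos-pos a>0 (ℤ.neg-mono-< (ℤ.+-mono-< E+c<0 B<0)))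
                           (sum-of-squares-pos E (ℤ.<⇒≢ B<0))

-- μ² = X + Y√d has norm 16 and exceeds 4, which pins down the position of
-- λ₁ = μ²/4 and of its conjugate relative to 0 and 1.
eigenvalue-bounds : ∀ {d X Y} → X ℤ.* X ≡ d ℤ.* (Y ℤ.* Y) ℤ.+ + 16 → + 4 ℤ.< X → + 0 ℤ.< Y →
                    PositiveSurd d (X ℤ.- + 4) Y × PositiveSurd d X (ℤ.- Y) × PositiveSurd d (+ 4 ℤ.- X) Y
eigenvalue-bounds {d} {X} {Y} X²≡dY²+16 X>4 Y>0 =
    inj₂ (X-4>0 , λ Y<0 → contradiction Y>0 (ℤ.<-asym Y<0))
  , inj₂ (X>0 , λ _ → dY²<X²)
  , inj₁ (Y>0 , λ _ → [4-X]²<dY²)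
  where
  X-4>0 : + 0 ℤ.< X ℤ.- + 4
  X-4>0 = ℤ.+-monoˡ-< (ℤ.- + 4) X>4

  X>0 : + 0 ℤ.< X
  X>0 = ℤ.<-trans (ℤ.+<+ (ℕ.s≤s ℕ.z≤n)) X>4

  dY²<X² : d ℤ.* (ℤ.- Y ℤ.* ℤ.- Y) ℤ.< X ℤ.* X
  dY²<X² = <-+pos (ℤ.+<+ (ℕ.s≤s ℕ.z≤n)) (trans (cong (λ z → d ℤ.* z ℤ.+ + 16) (negneg Y)) (sym X²≡dY²+16))
    where
    negneg : ∀ y → ℤ.- y ℤ.* ℤ.- y ≡ y ℤ.* y
    negneg = ℤ-Ring.solve-∀

  [4-X]²<dY² : (+ 4 ℤ.- X) ℤ.* (+ 4 ℤ.- X) ℤ.< d ℤ.* (Y ℤ.* Y)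
  [4-X]²<dY² = <-+pos (*-pos-pos {+ 8} (ℤ.+<+ (ℕ.s≤s ℕ.z≤n)) X-4>0) (begin
    (+ 4 ℤ.- X) ℤ.* (+ 4 ℤ.- X) ℤ.+ + 8 ℤ.* (X ℤ.- + 4)   ≡⟨ square X ⟩
    X ℤ.* X ℤ.- + 16                                      ≡⟨ cong (ℤ._- + 16) X²≡dY²+16 ⟩
    d ℤ.* (Y ℤ.* Y) ℤ.+ + 16 ℤ.- + 16                     ≡⟨ cancel (d ℤ.* (Y ℤ.* Y)) ⟩
    d ℤ.* (Y ℤ.* Y)                                       ∎)
    where
    open ≡-Reasoning
    square : ∀ x → (+ 4 ℤ.- x) ℤ.* (+ 4 ℤ.- x) ℤ.+ + 8 ℤ.* (x ℤ.- + 4) ≡ x ℤ.* x ℤ.- + 16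
    square = ℤ-Ring.solve-∀
    cancel : ∀ w → w ℤ.+ + 16 ℤ.- + 16 ≡ w
    cancel = ℤ-Ring.solve-∀

-- The eigenvectors, in ℤ[√d] and in ℚ(√D)

module Eigenvectors (p k r s : ℤ) where

  open ℤSpin.Eigen p k r s public
  private
    ρ : Vec ℤ 4
    ρ = p ∷ k ∷ r ∷ s ∷ []
    module Ex = E₄.Eigen (Ι 0F) (Ι 1F) (Ι 2F) (Ι 3F)

  q-eigen : [ + 4 ] •d Φ· q ≡ (μ *d μ) •d q
  q-eigen = by-ring⁶ ρ (Ex.[ Κ (+ 4) ] Ex.•d Ex.Φ· Ex.q) ((Ex.μ Ex.*d Ex.μ) Ex.•d Ex.q)
    refl refl refl refl refl refl

  cross-eigen : Φ· (q ×d σVd q) ≡ [ det₂ (p , k , r , s) ] •d (q ×d σVd q)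
  cross-eigen = by-ring⁶ ρ (Ex.Φ· (Ex.q Ex.×d Ex.σVd Ex.q))
    (Ex.[ E₄.det₂ (Ι 0F , Ι 1F , Ι 2F , Ι 3F) ] Ex.•d (Ex.q Ex.×d Ex.σVd Ex.q))
    refl refl refl refl refl refl

  q-null : q₁ *d q₁ +d q₂ *d q₂ ≡ q₃ *d q₃
  q-null = by-ring² ρ (Ex.q₁ Ex.*d Ex.q₁ Ex.+d Ex.q₂ Ex.*d Ex.q₂) (Ex.q₃ Ex.*d Ex.q₃) refl refl

  q₃-norm : q₃ *d σd q₃ ≡ [ m ℤ.* (B₁ ℤ.* B₁ ℤ.+ B₂ ℤ.* B₂) ]
  q₃-norm = by-ring² ρ (Ex.q₃ Ex.*d Ex.σd Ex.q₃)
                        Ex.[ Ex.m E₄.* (Ex.B₁ E₄.* Ex.B₁ E₄.+ Ex.B₂ E₄.* Ex.B₂) ] refl refl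

  q₁-q₃ : q₁ *d σd q₃ ≡ [ m ] *d ᾱ
  q₁-q₃ = by-ring² ρ (Ex.q₁ Ex.*d Ex.σd Ex.q₃) (Ex.[ Ex.m ] Ex.*d Ex.ᾱ) refl refl

  q₂-q₃ : q₂ *d σd q₃ ≡ [ m ] *d β̄
  q₂-q₃ = by-ring² ρ (Ex.q₂ Ex.*d Ex.σd Ex.q₃) (Ex.[ Ex.m ] Ex.*d Ex.β̄) refl refl

  -- μ² = X + Y√d
  X Y : ℤ
  X = τ ℤ.* τ ℤ.+ d
  Y = + 2 ℤ.* τ

  μ²-4 : μ *d μ -d [ + 4 ] ≡ (X ℤ.- + 4 , Y)
  μ²-4 = by-ring² ρ (Ex.μ Ex.*d Ex.μ Ex.-d Ex.[ Κ (+ 4) ])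
                     (Ex.τ E₄.* Ex.τ E₄.+ Ex.d E₄.- Κ (+ 4) , Κ (+ 2) E₄.* Ex.τ) refl refl

  σμ² : σd (μ *d μ) ≡ (X , ℤ.- Y)
  σμ² = by-ring² ρ (Ex.σd (Ex.μ Ex.*d Ex.μ))
                    (Ex.τ E₄.* Ex.τ E₄.+ Ex.d , Expr.⊝ (Κ (+ 2) E₄.* Ex.τ)) refl refl

  4-σμ² : [ + 4 ] -d σd (μ *d μ) ≡ (+ 4 ℤ.- X , Y)
  4-σμ² = by-ring² ρ (Ex.[ Κ (+ 4) ] Ex.-d Ex.σd (Ex.μ Ex.*d Ex.μ))
                      (Κ (+ 4) E₄.- (Ex.τ E₄.* Ex.τ E₄.+ Ex.d) , Κ (+ 2) E₄.* Ex.τ) refl refl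

  d-det : d ≡ τ ℤ.* τ ℤ.- + 4 ℤ.* det₂ (p , k , r , s)
  d-det = prove ρ Ex.d (Ex.τ E₄.* Ex.τ E₄.- Κ (+ 4) E₄.* E₄.det₂ (Ι 0F , Ι 1F , Ι 2F , Ι 3F)) refl

  X²-dY² : X ℤ.* X ≡ d ℤ.* (Y ℤ.* Y) ℤ.+ (τ ℤ.* τ ℤ.- d) ℤ.* (τ ℤ.* τ ℤ.- d)
  X²-dY² = identity τ d
    where
    identity : ∀ t d → (t ℤ.* t ℤ.+ d) ℤ.* (t ℤ.* t ℤ.+ d)
                       ≡ d ℤ.* ((+ 2 ℤ.* t) ℤ.* (+ 2 ℤ.* t)) ℤ.+ (t ℤ.* t ℤ.- d) ℤ.* (t ℤ.* t ℤ.- d)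
    identity = ℤ-Ring.solve-∀

  d-surd₁ : d ≡ e ℤ.* e ℤ.+ + 2 ℤ.* (+ 2 ℤ.* k) ℤ.* (+ 2 ℤ.* r)
  d-surd₁ = prove ρ Ex.d
    (Ex.e E₄.* Ex.e E₄.+ Κ (+ 2) E₄.* (Κ (+ 2) E₄.* Ι 1F) E₄.* (Κ (+ 2) E₄.* Ι 2F)) refl

  d-surd₂ : d ≡ ℤ.- e ℤ.* ℤ.- e ℤ.+ + 2 ℤ.* (+ 2 ℤ.* r) ℤ.* (+ 2 ℤ.* k)
  d-surd₂ = prove ρ Ex.d
    (Expr.⊝ Ex.e E₄.* Expr.⊝ Ex.e E₄.+ Κ (+ 2) E₄.* (Κ (+ 2) E₄.* Ι 2F) E₄.* (Κ (+ 2) E₄.* Ι 1F)) refl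

  B₁+B₂ : B₁ ℤ.+ B₂ ≡ + 2 ℤ.* r ℤ.+ + 2 ℤ.* k
  B₁+B₂ = prove ρ (Ex.B₁ E₄.+ Ex.B₂) (Κ (+ 2) E₄.* Ι 2F E₄.+ Κ (+ 2) E₄.* Ι 1F) refl

  module Embedding (D : ℕ) (D≡d : + D ≡ d) where

    open RQF D public
    open QuadraticField D public

    emb : Zd → K
    emb (a , b) = (ι a , ι b)

    embV : Vd → Vec3
    embV (x , y , z) = (emb x , emb y , emb z)

    emb-+ : ∀ x y → emb (x +d y) ≡ emb x +K emb y
    emb-+ (a , b) (a′ , b′) = cong₂ _,_ (ι-+ a a′) (ι-+ b b′)

    emb-sub : ∀ x y → emb (x -d y) ≡ emb x -K emb y
    emb-sub (a , b) (a′ , b′) = cong₂ _,_ (ι-sub a a′) (ι-sub b b′)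
      where
      ι-sub : ∀ x y → ι (x ℤ.- y) ≡ ι x ℚ.- ι y
      ι-sub x y = trans (ι-+ x (ℤ.- y)) (cong (ι x ℚ.+_) (ι-neg y))

    emb-* : ∀ x y → emb (x *d y) ≡ emb x *K emb y
    emb-* (a , b) (a′ , b′) = cong₂ _,_
      (trans (ι-+ (a ℤ.* a′) (d ℤ.* (b ℤ.* b′)))
             (cong₂ ℚ._+_ (ι-* a a′) (trans (ι-* d (b ℤ.* b′)) (cong₂ ℚ._*_ (cong ι (sym D≡d)) (ι-* b b′)))))
      (trans (ι-+ (a ℤ.* b′) (b ℤ.* a′)) (cong₂ ℚ._+_ (ι-* a b′) (ι-* b a′)))

    emb-σ : ∀ x → emb (σd x) ≡ σ (emb x)
    emb-σ (a , b) = cong (ι a ,_) (ι-neg b)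

    embV-σ : ∀ v → embV (σVd v) ≡ σV (embV v)
    embV-σ (x , y , z) = cong₂ _,_ (emb-σ x) (cong₂ _,_ (emb-σ y) (emb-σ z))

    embV-• : ∀ c v → embV (c •d v) ≡ emb c • embV v
    embV-• c (x , y , z) = cong₂ _,_ (emb-* c x) (cong₂ _,_ (emb-* c y) (emb-* c z))

    embV-× : ∀ v w → embV (v ×d w) ≡ embV v ×Q embV w
    embV-× (a₁ , b₁ , c₁) (a₂ , b₂ , c₂) =
      cong₂ _,_ (minor b₁ c₂ b₂ c₁) (cong₂ _,_ (minor a₂ c₁ a₁ c₂) (minor a₂ b₁ a₁ b₂))
      where
      minor : ∀ x y z w → emb (x *d y -d z *d w) ≡ emb x *K emb y -K emb z *K emb w
      minor x y z w = trans (emb-sub (x *d y) (z *d w)) (cong₂ _-K_ (emb-* x y) (emb-* z w))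

    ΦM-emb : ∀ v → ΦM (p , k , r , s) · embV v ≡ embV (Φ· v)
    ΦM-emb (x , y , z) = sym (cong₂ _,_ (row 0F) (cong₂ _,_ (row 1F) (row 2F)))
      where
      open ℤSpin using (Φ)
      row : ∀ i → let a = Φ (p , k , r , s) i in
            emb (([ a 0F ] *d x +d [ a 1F ] *d y) +d [ a 2F ] *d z)
            ≡ (fromℤK (a 0F) *K emb x +K fromℤK (a 1F) *K emb y) +K fromℤK (a 2F) *K emb z
      row i = let a = Φ (p , k , r , s) i in
        trans (emb-+ ([ a 0F ] *d x +d [ a 1F ] *d y) ([ a 2F ] *d z))
              (cong₂ _+K_ (trans (emb-+ ([ a 0F ] *d x) ([ a 1F ] *d y))
                                 (cong₂ _+K_ (emb-* [ a 0F ] x) (emb-* [ a 1F ] y)))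
                          (emb-* [ a 2F ] z))

nonSquare-between : ∀ {D} m → m ℕ.* m ℕ.< D → D ℕ.< ℕ.suc m ℕ.* ℕ.suc m → NonSquare D
nonSquare-between m below above n n²≡D with n ℕ.≤? m
... | yes n≤m = ℕ.<-irrefl n²≡D (ℕ.≤-<-trans (ℕ.*-mono-≤ n≤m n≤m) below)
... | no n≰m  = ℕ.<-irrefl (sym n²≡D) (ℕ.<-≤-trans above (ℕ.*-mono-≤ m<n m<n))
  where
  m<n : m ℕ.< n
  m<n = ℕ.≰⇒> n≰m

nonSquare-plus4 : ∀ {D} t → 2 ℕ.≤ t → D ≡ t ℕ.* t ℕ.+ 4 → NonSquare D
nonSquare-plus4 0 () _
nonSquare-plus4 1 (ℕ.s≤s ()) _
nonSquare-plus4 (ℕ.suc (ℕ.suc u)) _ refl = nonSquare-between (2 ℕ.+ u)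
  (ℕ.m<m+n _ (ℕ.s≤s ℕ.z≤n))
  (subst ((2 ℕ.+ u) ℕ.* (2 ℕ.+ u) ℕ.+ 4 ℕ.<_) (sym (square u)) (ℕ.m<m+n _ (ℕ.s≤s ℕ.z≤n)))
  where
  square : ∀ u → (3 ℕ.+ u) ℕ.* (3 ℕ.+ u) ≡ ((2 ℕ.+ u) ℕ.* (2 ℕ.+ u) ℕ.+ 4) ℕ.+ ℕ.suc (u ℕ.+ u)
  square = ℕ-Ring.solve-∀

nonSquare-minus4 : ∀ {D} t → 0 ℕ.< D → 4 ℕ.+ D ≡ t ℕ.* t → NonSquare D
nonSquare-minus4 0 _ ()
nonSquare-minus4 1 _ ()
nonSquare-minus4 2 D>0 refl = contradiction D>0 (λ ())
nonSquare-minus4 {D} (ℕ.suc (ℕ.suc (ℕ.suc u))) _ 4+D≡t² = nonSquare-between (2 ℕ.+ u)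
  (subst ((2 ℕ.+ u) ℕ.* (2 ℕ.+ u) ℕ.<_) (sym D≡) (ℕ.m<m+n _ (ℕ.s≤s ℕ.z≤n)))
  (subst (D ℕ.<_) 4+D≡t² (ℕ.m<n+m D (ℕ.s≤s ℕ.z≤n)))
  where
  square : ∀ u → (3 ℕ.+ u) ℕ.* (3 ℕ.+ u) ≡ 4 ℕ.+ ((2 ℕ.+ u) ℕ.* (2 ℕ.+ u) ℕ.+ ℕ.suc (u ℕ.+ u))
  square = ℕ-Ring.solve-∀
  D≡ : D ≡ (2 ℕ.+ u) ℕ.* (2 ℕ.+ u) ℕ.+ ℕ.suc (u ℕ.+ u)
  D≡ = ℕ.+-cancelˡ-≡ 4 D _ (trans 4+D≡t² (square u))

-- Products of the digit matrices

Spin₂ : Set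
Spin₂ = ℕ × ℕ × ℕ × ℕ

infixl 7 _∙ₙ_
_∙ₙ_ : Spin₂ → Spin₂ → Spin₂
(p , k , r , s) ∙ₙ (p′ , k′ , r′ , s′) =
  (p ℕ.* p′ ℕ.+ 2 ℕ.* k ℕ.* r′ , p ℕ.* k′ ℕ.+ k ℕ.* s′ , r ℕ.* p′ ℕ.+ s ℕ.* r′ , 2 ℕ.* r ℕ.* k′ ℕ.+ s ℕ.* s′)

⌜_⌝ : Spin₂ → Quad
⌜ p , k , r , s ⌝ = (+ p , + k , + r , + s)

⌜∙⌝ : ∀ A B → ⌜ A ∙ₙ B ⌝ ≡ ⌜ A ⌝ ∙ ⌜ B ⌝
⌜∙⌝ (p , k , r , s) (p′ , k′ , r′ , s′) =
  cong₂ _,_ (trans (cast p p′ (2 ℕ.* k) r′) (cong (λ x → + p ℤ.* + p′ ℤ.+ x ℤ.* + r′) (ℤ.pos-* 2 k)))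
  (cong₂ _,_ (cast p k′ k s′)
  (cong₂ _,_ (cast r p′ s r′)
             (trans (cast (2 ℕ.* r) k′ s s′) (cong (λ x → x ℤ.* + k′ ℤ.+ + s ℤ.* + s′) (ℤ.pos-* 2 r)))))
  where
  cast : ∀ a b c d → + (a ℕ.* b ℕ.+ c ℕ.* d) ≡ + a ℤ.* + b ℤ.+ + c ℤ.* + d
  cast a b c d = trans (ℤ.pos-+ (a ℕ.* b) (c ℕ.* d)) (cong₂ ℤ._+_ (ℤ.pos-* a b) (ℤ.pos-* c d))

spinᵈ : Digit → Spin₂
spinᵈ d1 = (1 , 1 , 0 , 1)
spinᵈ d2 = (1 , 1 , 1 , 1)
spinᵈ d3 = (1 , 0 , 1 , 1)

spinProd : List Digit → Spin₂
spinProd = foldr (λ d A → spinᵈ d ∙ₙ A) (1 , 0 , 0 , 1)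

Mᵈ≡ΦM : ∀ d → Mᵈ d ≡ ΦM ⌜ spinᵈ d ⌝
Mᵈ≡ΦM d1 = refl
Mᵈ≡ΦM d2 = refl
Mᵈ≡ΦM d3 = refl

prodM≡ΦM : ∀ ds i j → prodM ds i j ≡ ΦM ⌜ spinProd ds ⌝ i j
prodM≡ΦM []       i j = refl
prodM≡ΦM (d ∷ ds) i j = begin
  (Mᵈ d ⊗ prodM ds) i j
    ≡⟨ ⊗-congʳ (Mᵈ d) (prodM ds) (ΦM ⌜ spinProd ds ⌝) (λ l → prodM≡ΦM ds l j) ⟩
  (Mᵈ d ⊗ ΦM ⌜ spinProd ds ⌝) i j
    ≡⟨ cong (λ A → (A ⊗ ΦM ⌜ spinProd ds ⌝) i j) (Mᵈ≡ΦM d) ⟩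
  (ΦM ⌜ spinᵈ d ⌝ ⊗ ΦM ⌜ spinProd ds ⌝) i j
    ≡⟨ Φ-⊗ ⌜ spinᵈ d ⌝ ⌜ spinProd ds ⌝ i j ⟩
  ΦM (⌜ spinᵈ d ⌝ ∙ ⌜ spinProd ds ⌝) i j
    ≡⟨ cong (λ X → ΦM X i j) (⌜∙⌝ (spinᵈ d) (spinProd ds)) ⟨
  ΦM ⌜ spinᵈ d ∙ₙ spinProd ds ⌝ i j ∎
  where open ≡-Reasoning

DiagonalPositive : Spin₂ → Set
DiagonalPositive (p , _ , _ , s) = 1 ℕ.≤ p × 1 ℕ.≤ s

∙ₙ-diagonal : ∀ A B → DiagonalPositive A → DiagonalPositive B → DiagonalPositive (A ∙ₙ B)
∙ₙ-diagonal (p , k , r , s) (p′ , k′ , r′ , s′) (p≥1 , s≥1) (p′≥1 , s′≥1) =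
  ℕ.≤-trans (ℕ.*-mono-≤ p≥1 p′≥1) (ℕ.m≤m+n (p ℕ.* p′) _) ,
  ℕ.≤-trans (ℕ.*-mono-≤ s≥1 s′≥1) (ℕ.m≤n+m (s ℕ.* s′) _)

spinᵈ-diagonal : ∀ d → DiagonalPositive (spinᵈ d)
spinᵈ-diagonal d1 = ℕ.s≤s ℕ.z≤n , ℕ.s≤s ℕ.z≤n
spinᵈ-diagonal d2 = ℕ.s≤s ℕ.z≤n , ℕ.s≤s ℕ.z≤n
spinᵈ-diagonal d3 = ℕ.s≤s ℕ.z≤n , ℕ.s≤s ℕ.z≤n

spinProd-diagonal : ∀ ds → DiagonalPositive (spinProd ds)
spinProd-diagonal []       = ℕ.s≤s ℕ.z≤n , ℕ.s≤s ℕ.z≤n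
spinProd-diagonal (d ∷ ds) = ∙ₙ-diagonal (spinᵈ d) (spinProd ds) (spinᵈ-diagonal d) (spinProd-diagonal ds)

private
  *≡0⇒≡0 : ∀ m {n} → 1 ℕ.≤ m → m ℕ.* n ≡ 0 → n ≡ 0
  *≡0⇒≡0 m m≥1 mn≡0 with ℕ.m*n≡0⇒m≡0∨n≡0 m mn≡0
  ... | inj₁ refl = contradiction m≥1 (λ ())
  ... | inj₂ n≡0  = n≡0

upper lower : Spin₂ → ℕ
upper (_ , k , _ , _) = k
lower (_ , _ , r , _) = r

∙ₙ-lower≡0 : ∀ A B → DiagonalPositive A → DiagonalPositive B →
             lower (A ∙ₙ B) ≡ 0 → lower A ≡ 0 × lower B ≡ 0
∙ₙ-lower≡0 (p , k , r , s) (p′ , k′ , r′ , s′) (_ , s≥1) (p′≥1 , _) r″≡0 =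
  *≡0⇒≡0 p′ p′≥1 (trans (ℕ.*-comm p′ r) (ℕ.m+n≡0⇒m≡0 (r ℕ.* p′) r″≡0)) ,
  *≡0⇒≡0 s s≥1 (ℕ.m+n≡0⇒n≡0 (r ℕ.* p′) r″≡0)

∙ₙ-upper≡0 : ∀ A B → DiagonalPositive A → DiagonalPositive B →
             upper (A ∙ₙ B) ≡ 0 → upper A ≡ 0 × upper B ≡ 0
∙ₙ-upper≡0 (p , k , r , s) (p′ , k′ , r′ , s′) (p≥1 , _) (_ , s′≥1) k″≡0 =
  *≡0⇒≡0 s′ s′≥1 (trans (ℕ.*-comm s′ k) (ℕ.m+n≡0⇒n≡0 (p ℕ.* k′) k″≡0)) ,
  *≡0⇒≡0 p p≥1 (ℕ.m+n≡0⇒m≡0 (p ℕ.* k′) k″≡0)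

lower≡0⇒all-d1 : ∀ ds → lower (spinProd ds) ≡ 0 → All (_≡ d1) ds
lower≡0⇒all-d1 []       _  = []
lower≡0⇒all-d1 (d ∷ ds) r≡0 =
  let (r-d≡0 , r-ds≡0) = ∙ₙ-lower≡0 (spinᵈ d) (spinProd ds) (spinᵈ-diagonal d) (spinProd-diagonal ds) r≡0
  in  only-d1 d r-d≡0 ∷ lower≡0⇒all-d1 ds r-ds≡0
  where
  only-d1 : ∀ d → lower (spinᵈ d) ≡ 0 → d ≡ d1
  only-d1 d1 _ = refl

upper≡0⇒all-d3 : ∀ ds → upper (spinProd ds) ≡ 0 → All (_≡ d3) ds
upper≡0⇒all-d3 []       _  = []
upper≡0⇒all-d3 (d ∷ ds) k≡0 =
  let (k-d≡0 , k-ds≡0) = ∙ₙ-upper≡0 (spinᵈ d) (spinProd ds) (spinᵈ-diagonal d) (spinProd-diagonal ds) k≡0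
  in  only-d3 d k-d≡0 ∷ upper≡0⇒all-d3 ds k-ds≡0
  where
  only-d3 : ∀ d → upper (spinᵈ d) ≡ 0 → d ≡ d3
  only-d3 d3 _ = refl

Unit : ℤ → Set
Unit x = x ≡ + 1 ⊎ x ≡ -[1+ 0 ]

Unit-* : ∀ {x y} → Unit x → Unit y → Unit (x ℤ.* y)
Unit-* (inj₁ refl) (inj₁ refl) = inj₁ refl
Unit-* (inj₁ refl) (inj₂ refl) = inj₂ refl
Unit-* (inj₂ refl) (inj₁ refl) = inj₂ refl
Unit-* (inj₂ refl) (inj₂ refl) = inj₁ refl

Unit-cube : ∀ {x} → Unit x → x ℤ.* x ℤ.* x ≡ x
Unit-cube (inj₁ refl) = refl
Unit-cube (inj₂ refl) = refl

Unit-square : ∀ {x} → Unit x → x ℤ.* x ≡ + 1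
Unit-square (inj₁ refl) = refl
Unit-square (inj₂ refl) = refl

spinProd-det : ∀ ds → Unit (det₂ ⌜ spinProd ds ⌝)
spinProd-det []       = inj₁ refl
spinProd-det (d ∷ ds) = subst Unit (sym det-eq) (Unit-* (digit d) (spinProd-det ds))
  where
  det-eq : det₂ ⌜ spinᵈ d ∙ₙ spinProd ds ⌝ ≡ det₂ ⌜ spinᵈ d ⌝ ℤ.* det₂ ⌜ spinProd ds ⌝
  det-eq = trans (cong det₂ (⌜∙⌝ (spinᵈ d) (spinProd ds))) (det₂-∙ ⌜ spinᵈ d ⌝ ⌜ spinProd ds ⌝)
  digit : ∀ d → Unit (det₂ ⌜ spinᵈ d ⌝)
  digit d1 = inj₁ refl
  digit d2 = inj₂ refl
  digit d3 = inj₁ refl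

EigenStructure : Mat3 → Set
EigenStructure M =
  Σ ℕ λ D → NonSquare D × (let open RQF D in
    Σ K λ λ₁ → Σ K λ α → Σ K λ β →
      (1K <K λ₁) × (0K <K σ λ₁) × (σ λ₁ <K 1K)
      × (det3 M ≡ + 1 ⊎ det3 M ≡ -[1+ 0 ])
      × (∃[ w ] (IsEigenvector M λ₁ w × QNull w × Represents w α β))
      × In𝒬 α β
      × IsEigenvector M (σ λ₁) (σ α , σ β , 1K)
      × IsEigenvector M (fromℤK (det3 M)) ((α , β , 1K) ×Q (σ α , σ β , 1K)))

module SpinEigenvectors (p k r s : ℕ) (diagonal : DiagonalPositive (p , k , r , s))
                        (k≥1 : 1 ℕ.≤ k) (r≥1 : 1 ℕ.≤ r) (δ-unit : Unit (det₂ ⌜ p , k , r , s ⌝))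
                        (M : Mat3) (M≈Φ : ∀ i j → M i j ≡ ΦM ⌜ p , k , r , s ⌝ i j) where

  open Eigenvectors (+ p) (+ k) (+ r) (+ s)

  δ : ℤ
  δ = det₂ ⌜ p , k , r , s ⌝

  2k>0 : + 0 ℤ.< + 2 ℤ.* + k
  2k>0 = *-pos-pos {+ 2} (ℤ.+<+ (ℕ.s≤s ℕ.z≤n)) (ℤ.+<+ k≥1)

  2r>0 : + 0 ℤ.< + 2 ℤ.* + r
  2r>0 = *-pos-pos {+ 2} (ℤ.+<+ (ℕ.s≤s ℕ.z≤n)) (ℤ.+<+ r≥1)

  d>0 : + 0 ℤ.< d
  d>0 = subst (+ 0 ℤ.<_) (sym d-surd₁)
    (ℤ.+-mono-≤-< (square-nonneg e) (*-pos-pos (*-pos-pos {+ 2} (ℤ.+<+ (ℕ.s≤s ℕ.z≤n)) 2k>0) 2r>0))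

  D : ℕ
  D = ℤ.∣ d ∣

  D≡d : + D ≡ d
  D≡d = ℤ.0≤i⇒+∣i∣≡i (ℤ.<⇒≤ d>0)

  open Embedding D D≡d

  trace : ℕ
  trace = p ℕ.+ s

  trace≥2 : 2 ℕ.≤ trace
  trace≥2 = ℕ.+-mono-≤ (proj₁ diagonal) (proj₂ diagonal)

  τ² : τ ℤ.* τ ≡ + (trace ℕ.* trace)
  τ² = sym (ℤ.pos-* trace trace)

  D≡τ²-4δ : + D ≡ τ ℤ.* τ ℤ.- + 4 ℤ.* δ
  D≡τ²-4δ = trans D≡d d-det

  D-nonSquare : NonSquare D
  D-nonSquare = by-sign δ-unit
    where
    open ≡-Reasoning
    by-sign : Unit δ → NonSquare D
    by-sign (inj₂ δ≡-1) = nonSquare-plus4 trace trace≥2 (ℤ.+-injective (begin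
      + D                                 ≡⟨ D≡τ²-4δ ⟩
      τ ℤ.* τ ℤ.- + 4 ℤ.* δ               ≡⟨ cong (λ x → τ ℤ.* τ ℤ.- + 4 ℤ.* x) δ≡-1 ⟩
      τ ℤ.* τ ℤ.+ + 4                     ≡⟨ cong (ℤ._+ + 4) τ² ⟩
      + (trace ℕ.* trace) ℤ.+ + 4         ≡⟨ ℤ.pos-+ (trace ℕ.* trace) 4 ⟨
      + (trace ℕ.* trace ℕ.+ 4)           ∎))
    by-sign (inj₁ δ≡1) = nonSquare-minus4 trace D>0 (ℤ.+-injective (begin
      + (4 ℕ.+ D)                         ≡⟨ ℤ.pos-+ 4 D ⟩
      + 4 ℤ.+ + D                         ≡⟨ cong (λ x → + 4 ℤ.+ x) D≡τ²-4 ⟩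
      + 4 ℤ.+ (τ ℤ.* τ ℤ.- + 4)           ≡⟨ cancel (τ ℤ.* τ) ⟩
      τ ℤ.* τ                             ≡⟨ τ² ⟩
      + (trace ℕ.* trace)                 ∎))
      where
      D>0 : 0 ℕ.< D
      D>0 = ℤ.drop‿+<+ (subst (+ 0 ℤ.<_) (sym D≡d) d>0)
      D≡τ²-4 : + D ≡ τ ℤ.* τ ℤ.- + 4
      D≡τ²-4 = trans D≡τ²-4δ (cong (λ x → τ ℤ.* τ ℤ.- + 4 ℤ.* x) δ≡1)
      cancel : ∀ x → + 4 ℤ.+ (x ℤ.- + 4) ≡ x
      cancel = ℤ-Ring.solve-∀

  ¼ : K
  ¼ = fromℚ (+ 1 ℚ./ 4)

  λ₁ : K
  λ₁ = ¼ *K emb (μ *d μ)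

  M·embV : ∀ v → M · embV v ≡ embV (Φ· v)
  M·embV v = trans (·-cong M≈Φ (embV v)) (ΦM-emb v)

  M·q : M · embV q ≡ λ₁ • embV q
  M·q = begin
    M · embV q                                 ≡⟨ M·embV q ⟩
    embV (Φ· q)                                ≡⟨ •-identity (embV (Φ· q)) ⟨
    1K • embV (Φ· q)                           ≡⟨ cong (_• embV (Φ· q)) ¼·4 ⟨
    (¼ *K fromℤK (+ 4)) • embV (Φ· q)          ≡⟨ •-assoc ¼ (fromℤK (+ 4)) (embV (Φ· q)) ⟨
    ¼ • (fromℤK (+ 4) • embV (Φ· q))           ≡⟨ cong (¼ •_) (embV-• [ + 4 ] (Φ· q)) ⟨
    ¼ • embV ([ + 4 ] •d Φ· q)                 ≡⟨ cong (λ v → ¼ • embV v) q-eigen ⟩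
    ¼ • embV ((μ *d μ) •d q)                   ≡⟨ cong (¼ •_) (embV-• (μ *d μ) q) ⟩
    ¼ • (emb (μ *d μ) • embV q)                ≡⟨ •-assoc ¼ (emb (μ *d μ)) (embV q) ⟩
    λ₁ • embV q                                ∎
    where
    open ≡-Reasoning
    ¼·4 : ¼ *K fromℤK (+ 4) ≡ 1K
    ¼·4 = solve 0 (con (+ 1 ℚ./ 4) :* con (+ 4 ℚ./ 1) := con 1ℚ) refl
      where open K-Solver

  M·cross : M · embV (q ×d σVd q) ≡ fromℤK δ • embV (q ×d σVd q)
  M·cross = begin
    M · embV (q ×d σVd q)               ≡⟨ M·embV (q ×d σVd q) ⟩
    embV (Φ· (q ×d σVd q))              ≡⟨ cong embV cross-eigen ⟩
    embV ([ δ ] •d (q ×d σVd q))        ≡⟨ embV-• [ δ ] (q ×d σVd q) ⟩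
    fromℤK δ • embV (q ×d σVd q)        ∎
    where open ≡-Reasoning

  det3-M : det3 M ≡ δ
  det3-M = trans (det3-cong M≈Φ) (trans (det-Φ ⌜ p , k , r , s ⌝) (Unit-cube δ-unit))

  m>0 : + 0 ℤ.< m
  m>0 = *-pos-pos (*-pos-pos {+ 16} (ℤ.+<+ (ℕ.s≤s ℕ.z≤n)) (ℤ.+<+ r≥1)) (ℤ.+<+ r≥1)

  B₁>0⊎B₂>0 : + 0 ℤ.< B₁ ⊎ + 0 ℤ.< B₂
  B₁>0⊎B₂>0 with + 0 ℤ.<? B₁
  ... | yes B₁>0 = inj₁ B₁>0
  ... | no B₁≯0  = inj₂ (positive-summand (subst (+ 0 ℤ.<_) (sym B₁+B₂) (ℤ.+-mono-< 2r>0 2k>0)) (ℤ.≮⇒≥ B₁≯0))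

  N : ℤ
  N = m ℤ.* (B₁ ℤ.* B₁ ℤ.+ B₂ ℤ.* B₂)

  N>0 : + 0 ℤ.< N
  N>0 = *-pos-pos m>0 (squares B₁>0⊎B₂>0)
    where
    squares : + 0 ℤ.< B₁ ⊎ + 0 ℤ.< B₂ → + 0 ℤ.< B₁ ℤ.* B₁ ℤ.+ B₂ ℤ.* B₂
    squares (inj₁ B₁>0) = ℤ.+-mono-<-≤ (square-pos (λ B₁≡0 → ℤ.<⇒≢ B₁>0 (sym B₁≡0))) (square-nonneg B₂)
    squares (inj₂ B₂>0) = sum-of-squares-pos B₁ (λ B₂≡0 → ℤ.<⇒≢ B₂>0 (sym B₂≡0))

  instance
    ιN>0 : ℚ.Positive (ι N)
    ιN>0 = ℚ.positive (ι-< N>0)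
    ιN≢0 : ℚ.NonZero (ι N)
    ιN≢0 = ℚ.pos⇒nonZero (ι N)
    ιm>0 : ℚ.Positive (ι m)
    ιm>0 = ℚ.positive (ι-< m>0)

  N⁻¹ : ℚ
  N⁻¹ = ℚ.1/ ι N

  -- c = 1/q₃, computed as σ(q₃)/N
  c : K
  c = σ (emb q₃) *K fromℚ N⁻¹

  c-rationalises : ∀ x {y} → x *d σd q₃ ≡ y → c *K emb x ≡ fromℚ N⁻¹ *K emb y
  c-rationalises x {y} eq = begin
    (σ (emb q₃) *K fromℚ N⁻¹) *K emb x   ≡⟨ rearrange (σ (emb q₃)) (fromℚ N⁻¹) (emb x) ⟩
    fromℚ N⁻¹ *K (emb x *K σ (emb q₃))   ≡⟨ cong (λ z → fromℚ N⁻¹ *K (emb x *K z)) (emb-σ q₃) ⟨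
    fromℚ N⁻¹ *K (emb x *K emb (σd q₃))  ≡⟨ cong (fromℚ N⁻¹ *K_) (emb-* x (σd q₃)) ⟨
    fromℚ N⁻¹ *K emb (x *d σd q₃)        ≡⟨ cong (λ z → fromℚ N⁻¹ *K emb z) eq ⟩
    fromℚ N⁻¹ *K emb y                   ∎
    where
    open ≡-Reasoning
    rearrange : ∀ z n x → (z *K n) *K x ≡ n *K (x *K z)
    rearrange = solve 3 (λ z n x → (z :* n) :* x := n :* (x :* z)) refl
      where open K-Solver

  c·q₃ : c *K emb q₃ ≡ 1K
  c·q₃ = trans (c-rationalises q₃ q₃-norm) (trans (fromℚ-* N⁻¹ (ι N)) (cong fromℚ (ℚ.*-inverseˡ (ι N))))

  t : ℚ
  t = N⁻¹ ℚ.* ι m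

  t>0 : 0ℚ ℚ.< t
  t>0 = ℚ.positive⁻¹ t {{ℚ.pos*pos⇒pos N⁻¹ {{ℚ.1/pos⇒pos (ι N)}} (ι m)}}

  c·surd : ∀ x {y} → x *d σd q₃ ≡ [ m ] *d y → c *K emb x ≡ fromℚ t *K emb y
  c·surd x {y} eq = begin
    c *K emb x                             ≡⟨ c-rationalises x eq ⟩
    fromℚ N⁻¹ *K emb ([ m ] *d y)          ≡⟨ cong (fromℚ N⁻¹ *K_) (emb-* [ m ] y) ⟩
    fromℚ N⁻¹ *K (fromℚ (ι m) *K emb y)    ≡⟨ *K-assoc (fromℚ N⁻¹) (fromℚ (ι m)) (emb y) ⟨
    (fromℚ N⁻¹ *K fromℚ (ι m)) *K emb y    ≡⟨ cong (_*K emb y) (fromℚ-* N⁻¹ (ι m)) ⟩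
    fromℚ t *K emb y                       ∎
    where open ≡-Reasoning

  α β : K
  α = c *K emb q₁
  β = c *K emb q₂

  v₁ : Vec3
  v₁ = (α , β , 1K)

  v₁≡c•q : v₁ ≡ c • embV q
  v₁≡c•q = cong (λ z → α , β , z) (sym c·q₃)

  M·v₁ : M · v₁ ≡ λ₁ • v₁
  M·v₁ = subst (λ v → M · v ≡ λ₁ • v) (sym v₁≡c•q) (eigen-scale M λ₁ c (embV q) M·q)

  M·σv₁ : M · σV v₁ ≡ σ λ₁ • σV v₁
  M·σv₁ = trans (sym (σ-· M v₁)) (trans (cong σV M·v₁) (σ-• λ₁ v₁))

  v₁×σv₁ : v₁ ×Q σV v₁ ≡ (c *K σ c) • embV (q ×d σVd q)
  v₁×σv₁ = begin
    v₁ ×Q σV v₁                                  ≡⟨ cong (λ v → v ×Q σV v) v₁≡c•q ⟩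
    (c • embV q) ×Q σV (c • embV q)              ≡⟨ cong ((c • embV q) ×Q_) (σ-• c (embV q)) ⟩
    (c • embV q) ×Q (σ c • σV (embV q))          ≡⟨ ×Q-• c (σ c) (embV q) (σV (embV q)) ⟩
    (c *K σ c) • (embV q ×Q σV (embV q))         ≡⟨ cong (λ w → (c *K σ c) • (embV q ×Q w)) (embV-σ q) ⟨
    (c *K σ c) • (embV q ×Q embV (σVd q))        ≡⟨ cong ((c *K σ c) •_) (embV-× q (σVd q)) ⟨
    (c *K σ c) • embV (q ×d σVd q)               ∎
    where open ≡-Reasoning

  M·v₃ : M · (v₁ ×Q σV v₁) ≡ fromℤK (det3 M) • (v₁ ×Q σV v₁)
  M·v₃ = subst (λ z → M · (v₁ ×Q σV v₁) ≡ fromℤK z • (v₁ ×Q σV v₁)) (sym det3-M)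
    (subst (λ v → M · v ≡ fromℤK δ • v) (sym v₁×σv₁)
      (eigen-scale M (fromℤK δ) (c *K σ c) (embV (q ×d σVd q)) M·cross))

  α≡ : α ≡ fromℚ t *K emb ᾱ
  α≡ = c·surd q₁ q₁-q₃

  β≡ : β ≡ fromℚ t *K emb β̄
  β≡ = c·surd q₂ q₂-q₃

  irrational : ∀ y → + 0 ℤ.< proj₂ y → σ (fromℚ t *K emb y) ≢ fromℚ t *K emb y
  irrational (a , b) b>0 σ-fixed = ℚ.<-irrefl (sym tb≡0) tb>0
    where
    tb≡0 : t ℚ.* ι b ≡ 0ℚ
    tb≡0 = trans (sym (cong proj₂ (fromℚ-*ˡ t (ι a) (ι b)))) (σ-fixed⇒rational σ-fixed)
    tb>0 : 0ℚ ℚ.< t ℚ.* ι b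
    tb>0 = ℚ.positive⁻¹ (t ℚ.* ι b) {{ℚ.pos*pos⇒pos t {{ℚ.positive t>0}} (ι b) {{ℚ.positive (ι-< b>0)}}}}

  v₃≢0 : v₁ ×Q σV v₁ ≢ vec0
  v₃≢0 v₃≡0 = one-irrational B₁>0⊎B₂>0
    where
    one-irrational : + 0 ℤ.< B₁ ⊎ + 0 ℤ.< B₂ → ⊥
    one-irrational (inj₁ B₁>0) =
      irrational ᾱ B₁>0 (subst (λ x → σ x ≡ x) α≡ (proj₁ (conjugate-cross≡0 α β v₃≡0)))
    one-irrational (inj₂ B₂>0) =
      irrational β̄ B₂>0 (subst (λ x → σ x ≡ x) β≡ (proj₂ (conjugate-cross≡0 α β v₃≡0)))

  positive⇒nonneg : ∀ {x} → IsPos x → 0K ≤K x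
  positive⇒nonneg {x} x>0 = inj₂ (subst IsPos (sym (solve 1 (λ x → x :- con 0ℚ := x) refl x)) x>0)
    where open K-Solver

  α>0 : IsPos α
  α>0 = subst IsPos (sym α≡)
    (IsPos-scale (emb ᾱ) t>0 (IsPos-ι (trans D≡d d-surd₁) (surd-positive e 2k>0 2r>0)))

  β>0 : IsPos β
  β>0 = subst IsPos (sym β≡)
    (IsPos-scale (emb β̄) t>0 (IsPos-ι (trans D≡d d-surd₂) (surd-positive (ℤ.- e) 2r>0 2k>0)))

  circle : α *K α +K β *K β ≡ 1K
  circle = begin
    (c *K emb q₁) *K (c *K emb q₁) +K (c *K emb q₂) *K (c *K emb q₂)
      ≡⟨ factor c (emb q₁) (emb q₂) ⟩
    (c *K c) *K (emb q₁ *K emb q₁ +K emb q₂ *K emb q₂)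
      ≡⟨ cong ((c *K c) *K_)
              (trans (emb-+ (q₁ *d q₁) (q₂ *d q₂)) (cong₂ _+K_ (emb-* q₁ q₁) (emb-* q₂ q₂))) ⟨
    (c *K c) *K emb (q₁ *d q₁ +d q₂ *d q₂)
      ≡⟨ cong (λ z → (c *K c) *K emb z) q-null ⟩
    (c *K c) *K emb (q₃ *d q₃)
      ≡⟨ cong ((c *K c) *K_) (emb-* q₃ q₃) ⟩
    (c *K c) *K (emb q₃ *K emb q₃)
      ≡⟨ factor′ c (emb q₃) ⟩
    (c *K emb q₃) *K (c *K emb q₃)
      ≡⟨ cong₂ _*K_ c·q₃ c·q₃ ⟩
    1K *K 1K
      ≡⟨ *K-identityˡ 1K ⟩
    1K ∎
    where
    open ≡-Reasoning
    open K-Solver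
    factor : ∀ c x y → (c *K x) *K (c *K x) +K (c *K y) *K (c *K y) ≡ (c *K c) *K (x *K x +K y *K y)
    factor = solve 3 (λ c x y → (c :* x) :* (c :* x) :+ (c :* y) :* (c :* y) := (c :* c) :* (x :* x :+ y :* y)) refl
    factor′ : ∀ c z → (c *K c) *K (z *K z) ≡ (c *K z) *K (c *K z)
    factor′ = solve 2 (λ c z → (c :* c) :* (z :* z) := (c :* z) :* (c :* z)) refl

  X>4 : + 4 ℤ.< X
  X>4 = ℤ.+-mono-≤-< (subst (+ 4 ℤ.≤_) (sym τ²) (ℤ.+≤+ (ℕ.*-mono-≤ trace≥2 trace≥2))) d>0

  Y>0 : + 0 ℤ.< Y
  Y>0 = *-pos-pos {+ 2} (ℤ.+<+ (ℕ.s≤s ℕ.z≤n)) (ℤ.+<+ (ℕ.<-≤-trans (ℕ.s≤s ℕ.z≤n) trace≥2))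

  X²≡dY²+16 : X ℤ.* X ≡ d ℤ.* (Y ℤ.* Y) ℤ.+ + 16
  X²≡dY²+16 = trans X²-dY² (cong (λ z → d ℤ.* (Y ℤ.* Y) ℤ.+ z) (begin
    (τ ℤ.* τ ℤ.- d) ℤ.* (τ ℤ.* τ ℤ.- d)     ≡⟨ cong (λ z → z ℤ.* z) τ²-d ⟩
    (+ 4 ℤ.* δ) ℤ.* (+ 4 ℤ.* δ)             ≡⟨ square δ ⟩
    + 16 ℤ.* (δ ℤ.* δ)                      ≡⟨ cong (+ 16 ℤ.*_) (Unit-square δ-unit) ⟩
    + 16                                    ∎))
    where
    open ≡-Reasoning
    τ²-d : τ ℤ.* τ ℤ.- d ≡ + 4 ℤ.* δ
    τ²-d = trans (cong (λ z → τ ℤ.* τ ℤ.- z) d-det) (cancel (τ ℤ.* τ) (+ 4 ℤ.* δ))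
      where
      cancel : ∀ x y → x ℤ.- (x ℤ.- y) ≡ y
      cancel = ℤ-Ring.solve-∀
    square : ∀ δ → (+ 4 ℤ.* δ) ℤ.* (+ 4 ℤ.* δ) ≡ + 16 ℤ.* (δ ℤ.* δ)
    square = ℤ-Ring.solve-∀

  λ-bounds : PositiveSurd d (X ℤ.- + 4) Y × PositiveSurd d X (ℤ.- Y) × PositiveSurd d (+ 4 ℤ.- X) Y
  λ-bounds = eigenvalue-bounds {d} X²≡dY²+16 X>4 Y>0

  ¼>0 : 0ℚ ℚ.< + 1 ℚ./ 4
  ¼>0 = ℚ.positive⁻¹ (+ 1 ℚ./ 4)

  1<λ₁ : 1K <K λ₁
  1<λ₁ = subst IsPos (sym λ₁-1) (IsPos-scale (emb (X ℤ.- + 4 , Y)) ¼>0 (IsPos-ι D≡d (proj₁ λ-bounds)))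
    where
    open K-Solver
    open ≡-Reasoning
    λ₁-1 : λ₁ -K 1K ≡ ¼ *K emb (X ℤ.- + 4 , Y)
    λ₁-1 = begin
      ¼ *K emb (μ *d μ) -K 1K          ≡⟨ shift (emb (μ *d μ)) ⟩
      ¼ *K (emb (μ *d μ) -K emb [ + 4 ]) ≡⟨ cong (¼ *K_) (emb-sub (μ *d μ) [ + 4 ]) ⟨
      ¼ *K emb (μ *d μ -d [ + 4 ])     ≡⟨ cong (λ z → ¼ *K emb z) μ²-4 ⟩
      ¼ *K emb (X ℤ.- + 4 , Y)         ∎
      where
      shift : ∀ y → ¼ *K y -K 1K ≡ ¼ *K (y -K fromℤK (+ 4))
      shift = solve 1 (λ y → con (+ 1 ℚ./ 4) :* y :- con 1ℚ := con (+ 1 ℚ./ 4) :* (y :- con (+ 4 ℚ./ 1))) refl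

  0<σλ₁ : 0K <K σ λ₁
  0<σλ₁ = subst IsPos (sym σλ₁-0) (IsPos-scale (emb (X , ℤ.- Y)) ¼>0 (IsPos-ι D≡d (proj₁ (proj₂ λ-bounds))))
    where
    open K-Solver
    open ≡-Reasoning
    σλ₁-0 : σ λ₁ -K 0K ≡ ¼ *K emb (X , ℤ.- Y)
    σλ₁-0 = begin
      σ λ₁ -K 0K                      ≡⟨ solve 1 (λ y → y :- con 0ℚ := y) refl (σ λ₁) ⟩
      σ (¼ *K emb (μ *d μ))           ≡⟨ σ-* ¼ (emb (μ *d μ)) ⟩
      ¼ *K σ (emb (μ *d μ))           ≡⟨ cong (¼ *K_) (emb-σ (μ *d μ)) ⟨
      ¼ *K emb (σd (μ *d μ))          ≡⟨ cong (λ z → ¼ *K emb z) σμ² ⟩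
      ¼ *K emb (X , ℤ.- Y)            ∎

  σλ₁<1 : σ λ₁ <K 1K
  σλ₁<1 = subst IsPos (sym 1-σλ₁) (IsPos-scale (emb (+ 4 ℤ.- X , Y)) ¼>0 (IsPos-ι D≡d (proj₂ (proj₂ λ-bounds))))
    where
    open K-Solver
    open ≡-Reasoning
    1-σλ₁ : 1K -K σ λ₁ ≡ ¼ *K emb (+ 4 ℤ.- X , Y)
    1-σλ₁ = begin
      1K -K σ (¼ *K emb (μ *d μ))                ≡⟨ cong (λ z → 1K -K z) (σ-* ¼ (emb (μ *d μ))) ⟩
      1K -K ¼ *K σ (emb (μ *d μ))                ≡⟨ shift (σ (emb (μ *d μ))) ⟩
      ¼ *K (emb [ + 4 ] -K σ (emb (μ *d μ)))     ≡⟨ cong (λ z → ¼ *K (emb [ + 4 ] -K z)) (emb-σ (μ *d μ)) ⟨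
      ¼ *K (emb [ + 4 ] -K emb (σd (μ *d μ)))    ≡⟨ cong (¼ *K_) (emb-sub [ + 4 ] (σd (μ *d μ))) ⟨
      ¼ *K emb ([ + 4 ] -d σd (μ *d μ))          ≡⟨ cong (λ z → ¼ *K emb z) 4-σμ² ⟩
      ¼ *K emb (+ 4 ℤ.- X , Y)                   ∎
      where
      shift : ∀ y → 1K -K ¼ *K y ≡ ¼ *K (fromℤK (+ 4) -K y)
      shift = solve 1 (λ y → con 1ℚ :- con (+ 1 ℚ./ 4) :* y := con (+ 1 ℚ./ 4) :* (con (+ 4 ℚ./ 1) :- y)) refl

  result : EigenStructure M
  result = D , D-nonSquare , λ₁ , α , β , 1<λ₁ , 0<σλ₁ , σλ₁<1
         , subst Unit (sym det3-M) δ-unit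
         , (v₁ , (third≢0 , M·v₁) , Q-null , ((λ ()) , right-unit α , right-unit β))
         , (positive⇒nonneg α>0 , positive⇒nonneg β>0 , circle)
         , (third≢0 , M·σv₁)
         , (v₃≢0 , M·v₃)
    where
    open K-Solver
    third≢0 : ∀ {x y} → (x , y , 1K) ≢ vec0
    third≢0 ()
    Q-null : (α *K α +K β *K β) -K 1K *K 1K ≡ 0K
    Q-null = trans (cong (_-K 1K *K 1K) circle) (solve 0 (con 1ℚ :- con 1ℚ :* con 1ℚ := con 0ℚ) refl)
    right-unit : ∀ x → x ≡ x *K 1K
    right-unit = solve 1 (λ x → x := x :* con 1ℚ) refl

theorem3p7 : (ds : List Digit) →
    ¬ All (_≡ d1) ds → ¬ All (_≡ d3) ds →
    let M = prodM ds in
    Σ ℕ λ D → NonSquare D × (let open RQF D in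
      Σ K λ λ₁ → Σ K λ α → Σ K λ β →
        -- (1)
        (1K <K λ₁) × (0K <K σ λ₁) × (σ λ₁ <K 1K)
        × (det3 M ≡ + 1 ⊎ det3 M ≡ -[1+ 0 ])
        -- (2)
        × (∃[ w ] (IsEigenvector M λ₁ w × QNull w × Represents w α β))
        × In𝒬 α β
        -- (3)
        × IsEigenvector M (σ λ₁) (σ α , σ β , 1K)
        -- (4)
        × IsEigenvector M (fromℤK (det3 M)) ((α , β , 1K) ×Q (σ α , σ β , 1K)))
theorem3p7 ds not-all-d1 not-all-d3 =
  SpinEigenvectors.result (proj₁ A) (upper A) (lower A) (proj₂ (proj₂ (proj₂ A)))
    (spinProd-diagonal ds)
    (ℕ.n≢0⇒n>0 (λ k≡0 → not-all-d3 (upper≡0⇒all-d3 ds k≡0)))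
    (ℕ.n≢0⇒n>0 (λ r≡0 → not-all-d1 (lower≡0⇒all-d1 ds r≡0)))
    (spinProd-det ds) (prodM ds) (prodM≡ΦM ds)
  where
  A : Spin₂
  A = spinProd ds
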